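{- Let $L$ be a free abelian group of finite rank $n$ and $R$ a ring. (a) Let $L'\subseteq L$ be a subgroup of rank $n$ whose index $d=[L:L']$ is invertible in $R$. Then restriction $\mathrm{Int}(L,R)\to\mathrm{Int}(L',R)$, $f\mapsto f|_{L'}$, is an isomorphism. (b) For every $f\in\mathrm{Int}(L,R)$ there exist finitely many $f_1,\dots,f_r,g_1,\dots,g_r\in\mathrm{Int}(L,R)$ such that $\tau_\lambda(f)=\sum_{i=1}^r g_i(\lambda)f_i$ for every $\lambda\in L$.
   Context: $\mathrm{Int}(L,\mathbb Z)$ is the ring of maps $f:L\to\mathbb Z$ such that for a (equivalently any) $\mathbb Z$-basis $\lambda_1,\dots,\lambda_n$ of $L$ there is $P\in\mathbb Q[X_1,\dots,X_n]$ with $f(\sum x_i\lambda_i)=P(x_1,\dots,x_n)$ for all $(x_i)\in\mathbb Z^n$. For a ring $R$, $\mathrm{Int}(L,R):=\mathrm{Int}(L,\mathbb Z)\otimes R$; an element $f=\sum_j h_j\otimes a_j$ has values $f(\lambda)=\sum_j h_j(\lambda)a_j\in R$. Restriction to $L'$ and translation $\tau_\lambda$ (induced by $h\mapsto(x\mapsto h(x+\lambda))$) are the maps on $\mathrm{Int}(\cdot,\mathbb Z)$ extended $R$-linearly. -}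

module Defs where

open import Level using (_⊔_)
open import Data.Nat as ℕ using (ℕ; zero; suc)
open import Data.Integer as ℤ using (ℤ; +_; -[1+_]; ∣_∣)
import Data.Integer.Properties as ℤP
open import Data.Rational as ℚ using (ℚ; _/_)
import Data.Rational.Properties as ℚP
import Data.Rational.Unnormalised as ℚᵘ
import Data.Rational.Unnormalised.Properties as ℚᵘP
open import Data.Fin using (Fin; zero; suc; punchIn)
open import Data.List using (List; []; _∷_; _++_; map; concatMap)
open import Data.Product using (_×_; _,_; Σ; ∃)
import Data.Product
open import Function using (_∘_)
open import Relation.Binary.PropositionalEquality
open import Algebra.Bundles using (CommutativeRing)

-- The lattice L is taken to be ℤ^n (a free abelian group of rank n
-- with a chosen basis); points are functions Fin n → ℤ.

Pt : ℕ → Set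
Pt n = Fin n → ℤ

ι : ℤ → ℚ
ι z = z / 1

private
  ιᵘ : ∀ z → ℚ.toℚᵘ (ι z) ℚᵘ.≃ ℚᵘ.mkℚᵘ z 0
  ιᵘ z = ℚP.toℚᵘ-fromℚᵘ (ℚᵘ.mkℚᵘ z 0)

ι-+ : ∀ a b → ι (a ℤ.+ b) ≡ ι a ℚ.+ ι b
ι-+ a b = ℚP.toℚᵘ-injective
  (ℚᵘP.≃-trans (ιᵘ (a ℤ.+ b))
  (ℚᵘP.≃-trans (ℚᵘ.*≡* eq)
  (ℚᵘP.≃-trans (ℚᵘP.+-cong (ℚᵘP.≃-sym (ιᵘ a)) (ℚᵘP.≃-sym (ιᵘ b)))
               (ℚᵘP.≃-sym (ℚP.toℚᵘ-homo-+ (ι a) (ι b))))))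
  where
  eq : (a ℤ.+ b) ℤ.* + 1 ≡ (a ℤ.* + 1 ℤ.+ b ℤ.* + 1) ℤ.* + 1
  eq rewrite ℤP.*-identityʳ (a ℤ.+ b) | ℤP.*-identityʳ a | ℤP.*-identityʳ b
           | ℤP.*-identityʳ (a ℤ.+ b) = refl

ι-* : ∀ a b → ι (a ℤ.* b) ≡ ι a ℚ.* ι b
ι-* a b = ℚP.toℚᵘ-injective
  (ℚᵘP.≃-trans (ιᵘ (a ℤ.* b))
  (ℚᵘP.≃-trans (ℚᵘ.*≡* refl)
  (ℚᵘP.≃-trans (ℚᵘP.*-cong (ℚᵘP.≃-sym (ιᵘ a)) (ℚᵘP.≃-sym (ιᵘ b)))
               (ℚᵘP.≃-sym (ℚP.toℚᵘ-homo-* (ι a) (ι b))))))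

-- Polynomials in ℚ[X_1,…,X_n], given as polynomial expressions
-- (every polynomial is the value of such an expression).

infixl 6 _⊕_
infixl 7 _⊛_

data Poly (n : ℕ) : Set where
  con  : ℚ → Poly n
  var  : Fin n → Poly n
  _⊕_  : Poly n → Poly n → Poly n
  _⊛_  : Poly n → Poly n → Poly n

eval : ∀ {n} → Poly n → (Fin n → ℚ) → ℚ
eval (con q) ρ = q
eval (var i) ρ = ρ i
eval (p ⊕ q) ρ = eval p ρ ℚ.+ eval q ρ
eval (p ⊛ q) ρ = eval p ρ ℚ.* eval q ρ

eval-cong : ∀ {n} (P : Poly n) {ρ ρ′ : Fin n → ℚ} → (∀ i → ρ i ≡ ρ′ i) →
            eval P ρ ≡ eval P ρ′
eval-cong (con q) e = refl
eval-cong (var i) e = e i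
eval-cong (p ⊕ q) e = cong₂ ℚ._+_ (eval-cong p e) (eval-cong q e)
eval-cong (p ⊛ q) e = cong₂ ℚ._*_ (eval-cong p e) (eval-cong q e)

substP : ∀ {m n} → Poly m → (Fin m → Poly n) → Poly n
substP (con q) σ = con q
substP (var i) σ = σ i
substP (p ⊕ q) σ = substP p σ ⊕ substP q σ
substP (p ⊛ q) σ = substP p σ ⊛ substP q σ

eval-subst : ∀ {m n} (P : Poly m) (σ : Fin m → Poly n) ρ →
             eval (substP P σ) ρ ≡ eval P (λ j → eval (σ j) ρ)
eval-subst (con q) σ ρ = refl
eval-subst (var i) σ ρ = refl
eval-subst (p ⊕ q) σ ρ = cong₂ ℚ._+_ (eval-subst p σ ρ) (eval-subst q σ ρ)
eval-subst (p ⊛ q) σ ρ = cong₂ ℚ._*_ (eval-subst p σ ρ) (eval-subst q σ ρ)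

-- Int(ℤ^n, ℤ): maps f : ℤ^n → ℤ agreeing on ℤ^n with some P ∈ ℚ[X_1..X_n].

record IntZ (n : ℕ) : Set where
  constructor mkIntZ
  field
    fun    : Pt n → ℤ
    poly   : Poly n
    isPoly : ∀ x → ι (fun x) ≡ eval poly (ι ∘ x)
open IntZ public

Mat : ℕ → Set
Mat n = Fin n → Fin n → ℤ

sumℤ : ∀ {n} → (Fin n → ℤ) → ℤ
sumℤ {zero}  f = + 0
sumℤ {suc n} f = f zero ℤ.+ sumℤ (f ∘ suc)

altSum : ∀ {n} → (Fin n → ℤ) → ℤ
altSum {zero}  f = + 0
altSum {suc n} f = f zero ℤ.- altSum (f ∘ suc)

det : ∀ {n} → Mat n → ℤ
det {zero}  M = + 1
det {suc n} M = altSum (λ j → M zero j ℤ.* det (λ i k → M (suc i) (punchIn j k)))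

-- x ↦ M x ; the columns of M form a basis of the sublattice L' = M ℤ^n
apply : ∀ {n} → Mat n → Pt n → Pt n
apply M x i = sumℤ (λ j → M i j ℤ.* x j)

private
  sumP : ∀ {m n} → (Fin m → Poly n) → Poly n
  sumP {zero}  f = con (ι (+ 0))
  sumP {suc m} f = f zero ⊕ sumP (f ∘ suc)

  eval-sumP : ∀ {m n} (f : Fin m → Poly n) (g : Fin m → ℤ) ρ →
              (∀ j → eval (f j) ρ ≡ ι (g j)) → eval (sumP f) ρ ≡ ι (sumℤ g)
  eval-sumP {zero}  f g ρ e = refl
  eval-sumP {suc m} f g ρ e =
    trans (cong₂ ℚ._+_ (e zero) (eval-sumP (f ∘ suc) (g ∘ suc) ρ (e ∘ suc)))
          (sym (ι-+ (g zero) (sumℤ (g ∘ suc))))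

linP : ∀ {n} → Mat n → Fin n → Poly n
linP M i = sumP (λ j → con (ι (M i j)) ⊛ var j)

eval-linP : ∀ {n} (M : Mat n) (x : Pt n) i → eval (linP M i) (ι ∘ x) ≡ ι (apply M x i)
eval-linP M x i = eval-sumP _ _ (ι ∘ x) (λ j → sym (ι-* (M i j) (x j)))

-- h ↦ h ∘ M  : restriction of h to L' = M ℤ^n, read in the basis given by M
restrictZ : ∀ {n} → Mat n → IntZ n → IntZ n
restrictZ M h = mkIntZ (λ x → fun h (apply M x)) (substP (poly h) (linP M)) pf
  where
  pf : ∀ x → ι (fun h (apply M x)) ≡ eval (substP (poly h) (linP M)) (ι ∘ x)
  pf x = trans (isPoly h (apply M x))
         (trans (eval-cong (poly h) (λ i → sym (eval-linP M x i)))
                (sym (eval-subst (poly h) (linP M) (ι ∘ x))))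

shiftZ : ∀ {n} → Pt n → IntZ n → IntZ n
shiftZ l h = mkIntZ (λ x → fun h (λ i → x i ℤ.+ l i)) (substP (poly h) σ) pf
  where
  σ = λ i → var i ⊕ con (ι (l i))
  pf : ∀ x → _
  pf x = trans (isPoly h (λ i → x i ℤ.+ l i))
         (trans (eval-cong (poly h) (λ i → ι-+ (x i) (l i)))
                (sym (eval-subst (poly h) σ (ι ∘ x))))

-- Int(ℤ^n, R) = Int(ℤ^n, ℤ) ⊗_ℤ R, presented as formal sums Σ h_j ⊗ a_j
-- (lists) modulo the equivalence generated by the defining relations of
-- the tensor product of abelian groups.

module Tensor {c ℓ} (R : CommutativeRing c ℓ) where
  open CommutativeRing R

  natR : ℕ → Carrier
  natR zero    = 0#
  natR (suc k) = 1# + natR k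

  fromℤ : ℤ → Carrier
  fromℤ (+ k)      = natR k
  fromℤ -[1+ k ]   = - natR (suc k)

  IsUnit : Carrier → Set (c ⊔ ℓ)
  IsUnit a = Σ Carrier (λ u → a * u ≈ 1#)

  -- formal sums; _++_ is addition
  IntR : ℕ → Set c
  IntR n = List (IntZ n × Carrier)

  infix 4 _∼_
  data _∼_ {n : ℕ} : IntR n → IntR n → Set (c ⊔ ℓ) where
    ∼-refl  : ∀ {f} → f ∼ f
    ∼-sym   : ∀ {f g} → f ∼ g → g ∼ f
    ∼-trans : ∀ {f g k} → f ∼ g → g ∼ k → f ∼ k
    ∼-++    : ∀ {f f′ g g′} → f ∼ f′ → g ∼ g′ → f ++ g ∼ f′ ++ g′
    ∼-comm  : ∀ f g → f ++ g ∼ g ++ f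
    ∼-congˡ : ∀ (h h′ : IntZ n) a → (∀ x → fun h x ≡ fun h′ x) →
              ((h , a) ∷ []) ∼ ((h′ , a) ∷ [])
    ∼-congʳ : ∀ (h : IntZ n) a b → a ≈ b → ((h , a) ∷ []) ∼ ((h , b) ∷ [])
    ∼-addˡ  : ∀ (h h′ h″ : IntZ n) a → (∀ x → fun h″ x ≡ fun h x ℤ.+ fun h′ x) →
              ((h″ , a) ∷ []) ∼ ((h , a) ∷ (h′ , a) ∷ [])
    ∼-addʳ  : ∀ (h : IntZ n) a b →
              ((h , a + b) ∷ []) ∼ ((h , a) ∷ (h , b) ∷ [])
    ∼-zero  : ∀ (h : IntZ n) → ((h , 0#) ∷ []) ∼ []

  value : ∀ {n} → IntR n → Pt n → Carrier
  value []              x = 0#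
  value ((h , a) ∷ f)   x = fromℤ (fun h x) * a + value f x

  scale : ∀ {n} → Carrier → IntR n → IntR n
  scale r = map (λ p → Data.Product.proj₁ p , r * Data.Product.proj₂ p)

  restrict : ∀ {n} → Mat n → IntR n → IntR n
  restrict M = map (λ p → restrictZ M (Data.Product.proj₁ p) , Data.Product.proj₂ p)

  translate : ∀ {n} → Pt n → IntR n → IntR n
  translate l = map (λ p → shiftZ l (Data.Product.proj₁ p) , Data.Product.proj₂ p)

  combo : ∀ {n} → Pt n → List (IntR n × IntR n) → IntR n
  combo l = concatMap (λ p → scale (value (Data.Product.proj₂ p) l) (Data.Product.proj₁ p))

-- Part (b) is Newton's interpolation formula: if h has degree < N then
--   h (x + l) = Σ_{k ∈ [0,N)ⁿ} binom(l, k) · (Δᵏ h)(x),   binom(l, k) = Π_i binom(l_i, k_i),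
-- so τ_l (h ⊗ a) = Σ_k binom(l, k) · (Δᵏ h ⊗ a).
-- Part (a): with X = ± adj M, both M X and X M are multiplication by d = |det M|, so restricting
-- along M and then along X (or in the other order) is the dilation f ↦ f (d ·); it suffices to show
-- that dilation is bijective when d is a unit of R. By Newton's formula at x = 0 the binomials
-- binom(·, k) form a basis of Int(L, ℤ), in which the dilation is triangular: binom(d x, k) is a
-- combination of the binom(x, j) with j ≤ k coordinatewise, and the coefficient of binom(x, k) is
-- d^|k|. A triangular map with unit diagonal is invertible, by induction on |k|.

module Submission where

open import Defs
open import Level using (Level)
open import Data.Nat using (ℕ)
open import Data.Integer using (ℤ; +_; ∣_∣)
open import Data.List using (List)
open import Data.Product using (_×_; Σ)
open import Data.Product using (_,_)
open import Relation.Binary.PropositionalEquality using (_≢_)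
open import Algebra.Bundles using (CommutativeRing)

module Integers where

  open import Data.Nat using (zero; suc)
  import Data.Nat.Properties as ℕP
  open import Data.Integer as ℤ using (-[1+_])
  import Data.Integer.Properties as ℤP
  import Data.Integer.GCD as ℤG
  open import Data.Rational as ℚ using ()
  import Data.Rational.Properties as ℚP
  open import Algebra.Properties.Group ℚP.+-0-group using (inverseʳ-unique)
  open import Relation.Binary.PropositionalEquality

  ↥-ι : ∀ a → ℚ.↥ (ι a) ≡ a
  ↥-ι a = trans (sym (ℤP.*-identityʳ _))
                (trans (cong (ℚ.↥ (ι a) ℤ.*_) (sym (ℤG.gcd-zeroʳ a))) (ℚP.↥-/ a 1))

  ι-injective : ∀ {a b} → ι a ≡ ι b → a ≡ b
  ι-injective {a} {b} eq = trans (sym (↥-ι a)) (trans (cong ℚ.↥_ eq) (↥-ι b))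

  ι-neg : ∀ a → ι (ℤ.- a) ≡ ℚ.- ι a
  ι-neg a = inverseʳ-unique (ι a) (ι (ℤ.- a))
              (trans (sym (ι-+ a (ℤ.- a))) (cong ι (ℤP.+-inverseʳ a)))

  ι-sub : ∀ a b → ι (a ℤ.- b) ≡ ι a ℚ.- ι b
  ι-sub a b = trans (ι-+ a (ℤ.- b)) (cong (ι a ℚ.+_) (ι-neg b))

  succ : ℤ → ℤ
  succ t = t ℤ.+ + 1

  ℤ-induction : ∀ {p} (P : ℤ → Set p) → P (+ 0) →
                (∀ t → P t → P (succ t)) → (∀ t → P (succ t) → P t) → ∀ t → P t
  ℤ-induction P P0 up down (+ zero)     = P0
  ℤ-induction P P0 up down (+ suc m)    =
    subst P (cong +_ (ℕP.+-comm m 1)) (up (+ m) (ℤ-induction P P0 up down (+ m)))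
  ℤ-induction P P0 up down -[1+ zero ]  = down -[1+ zero ] P0
  ℤ-induction P P0 up down -[1+ suc m ] = down -[1+ suc m ] (ℤ-induction P P0 up down -[1+ m ])

module RationalDifferences {ℓ} {A : Set ℓ} (step : A → A) where

  open import Data.Nat as ℕ using (zero; suc; _≤_; z≤n; s≤s)
  import Data.Nat.Properties as ℕP
  open import Data.Rational as ℚ using (ℚ; 0ℚ)
  import Data.Rational.Properties as ℚP
  open import Data.Rational.Solver using (module +-*-Solver)
  open +-*-Solver using (solve; _:+_; _:-_; _:*_; _:=_)
  open import Function using (_∘_)
  open import Relation.Binary.PropositionalEquality

  Δ : (A → ℚ) → A → ℚ
  Δ F x = F (step x) ℚ.- F x

  Δ^ : ℕ → (A → ℚ) → A → ℚ
  Δ^ zero    F = F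
  Δ^ (suc m) F = Δ^ m (Δ F)

  Annihilated : ℕ → (A → ℚ) → Set ℓ
  Annihilated m F = ∀ x → Δ^ m F x ≡ 0ℚ

  Δ^-cong : ∀ m {F G} → F ≗ G → Δ^ m F ≗ Δ^ m G
  Δ^-cong zero    F≗G = F≗G
  Δ^-cong (suc m) F≗G = Δ^-cong m (λ x → cong₂ ℚ._-_ (F≗G (step x)) (F≗G x))

  Δ^-suc : ∀ m F → Δ^ (suc m) F ≗ Δ (Δ^ m F)
  Δ^-suc zero    F x = refl
  Δ^-suc (suc m) F x = Δ^-suc m (Δ F) x

  Δ^-step : ∀ m F → Δ^ m (F ∘ step) ≗ Δ^ m F ∘ step
  Δ^-step zero    F x = refl
  Δ^-step (suc m) F x = Δ^-step m (Δ F) x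

  annihilated-cong : ∀ m {F G} → F ≗ G → Annihilated m F → Annihilated m G
  annihilated-cong m F≗G ann x = trans (sym (Δ^-cong m F≗G x)) (ann x)

  annihilated-zero : ∀ m {F} → (∀ x → F x ≡ 0ℚ) → Annihilated m F
  annihilated-zero zero    F≡0 = F≡0
  annihilated-zero (suc m) F≡0 =
    annihilated-zero m (λ x → cong₂ ℚ._-_ (F≡0 (step x)) (F≡0 x))

  annihilated-suc : ∀ m F → Annihilated m F → Annihilated (suc m) F
  annihilated-suc m F ann x = trans (Δ^-suc m F x) (cong₂ ℚ._-_ (ann (step x)) (ann x))

  annihilated-≤ : ∀ {m m′} F → m ≤ m′ → Annihilated m F → Annihilated m′ F
  annihilated-≤ {zero}  {zero}   F z≤n       ann = ann
  annihilated-≤ {zero}  {suc m′} F z≤n       ann =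
    annihilated-suc m′ F (annihilated-≤ {zero} {m′} F z≤n ann)
  annihilated-≤ {suc m} {suc m′} F (s≤s m≤m′) ann = annihilated-≤ (Δ F) m≤m′ ann

  annihilated-+ : ∀ m F G → Annihilated m F → Annihilated m G →
                  Annihilated m (λ x → F x ℚ.+ G x)
  annihilated-+ zero    F G annF annG x = cong₂ ℚ._+_ (annF x) (annG x)
  annihilated-+ (suc m) F G annF annG =
    annihilated-cong m (λ x → sym (Δ-+ x)) (annihilated-+ m (Δ F) (Δ G) annF annG)
    where
    Δ-+ : ∀ x → Δ (λ y → F y ℚ.+ G y) x ≡ Δ F x ℚ.+ Δ G x
    Δ-+ x = solve 4 (λ a b c d → (a :+ b) :- (c :+ d) := (a :- c) :+ (b :- d)) refl
                    (F (step x)) (G (step x)) (F x) (G x)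

  Δ-* : ∀ F G x → Δ (λ y → F y ℚ.* G y) x ≡ Δ F x ℚ.* G (step x) ℚ.+ F x ℚ.* Δ G x
  Δ-* F G x = solve 4 (λ a b c d → a :* b :- c :* d := (a :- c) :* b :+ c :* (b :- d)) refl
                      (F (step x)) (G (step x)) (F x) (G x)

  annihilated-* : ∀ a b F G → Annihilated (suc a) F → Annihilated (suc b) G →
                  Annihilated (suc (a ℕ.+ b)) (λ x → F x ℚ.* G x)
  annihilated-* a b F G annF annG =
    annihilated-cong (a ℕ.+ b) (λ x → sym (Δ-* F G x))
      (annihilated-+ (a ℕ.+ b) _ _ (left a annF) (right b annG))
    where
    left : ∀ a → Annihilated (suc a) F → Annihilated (a ℕ.+ b) (λ x → Δ F x ℚ.* G (step x))
    left zero    annF = annihilated-zero b (λ x → trans (cong (ℚ._* G (step x)) (annF x))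
                                                        (ℚP.*-zeroˡ (G (step x))))
    left (suc a) annF = annihilated-* a b (Δ F) (G ∘ step) annF
                          (λ x → trans (Δ^-step (suc b) G x) (annG (step x)))
    right : ∀ b → Annihilated (suc b) G → Annihilated (a ℕ.+ b) (λ x → F x ℚ.* Δ G x)
    right zero    annG = annihilated-zero (a ℕ.+ 0) (λ x → trans (cong (F x ℚ.*_) (annG x))
                                                                   (ℚP.*-zeroʳ (F x)))
    right (suc b) annG = subst (λ k → Annihilated k (λ x → F x ℚ.* Δ G x))
                           (sym (ℕP.+-suc a b)) (annihilated-* a b F (Δ G) annF annG)

module IntegerDifferences where

  open import Data.Nat using (zero; suc)
  open import Data.Integer as ℤ using ()
  import Data.Integer.Properties as ℤP
  open import Data.Integer.Solver using (module +-*-Solver)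
  open +-*-Solver using (solve; _:+_; _:-_; _:*_; _:=_)
  open import Data.Fin using (Fin; zero; suc)
  open import Algebra.Properties.CommutativeMonoid.Sum ℤP.+-0-commutativeMonoid using (sum)
  open import Function using (_∘_)
  open import Relation.Binary.PropositionalEquality
  open Integers using (ι-sub; ι-injective)

  private variable
    ℓ : Level
    A B : Set ℓ

  Δ : (A → A) → (A → ℤ) → A → ℤ
  Δ s F x = F (s x) ℤ.- F x

  Δ^ : (A → A) → ℕ → (A → ℤ) → A → ℤ
  Δ^ s zero    F = F
  Δ^ s (suc m) F = Δ^ s m (Δ s F)

  Δ^-cong : ∀ (s : A → A) m {F G} → F ≗ G → Δ^ s m F ≗ Δ^ s m G
  Δ^-cong s zero    F≗G = F≗G
  Δ^-cong s (suc m) F≗G = Δ^-cong s m (λ x → cong₂ ℤ._-_ (F≗G (s x)) (F≗G x))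

  Δ^-zero : ∀ (s : A → A) m {F} → F ≗ (λ _ → + 0) → Δ^ s m F ≗ (λ _ → + 0)
  Δ^-zero s zero    F≗0 = F≗0
  Δ^-zero s (suc m) F≗0 = Δ^-zero s m (λ x → cong₂ ℤ._-_ (F≗0 (s x)) (F≗0 x))

  Δ^-∘ : ∀ {s : A → A} {t : B → B} {h : A → B} → (∀ x → h (s x) ≡ t (h x)) →
         ∀ m F → Δ^ s m (F ∘ h) ≗ Δ^ t m F ∘ h
  Δ^-∘ comm zero    F x = refl
  Δ^-∘ {s = s} {t} {h} comm (suc m) F x =
    trans (Δ^-cong s m (λ y → cong (λ z → F z ℤ.- F (h y)) (comm y)) x) (Δ^-∘ comm m (Δ t F) x)

  Δ^-+ : ∀ (s : A → A) m F G → Δ^ s m (λ x → F x ℤ.+ G x) ≗ (λ x → Δ^ s m F x ℤ.+ Δ^ s m G x)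
  Δ^-+ s zero    F G x = refl
  Δ^-+ s (suc m) F G x = trans (Δ^-cong s m Δ-+ x) (Δ^-+ s m (Δ s F) (Δ s G) x)
    where
    Δ-+ : ∀ y → Δ s (λ x → F x ℤ.+ G x) y ≡ Δ s F y ℤ.+ Δ s G y
    Δ-+ y = solve 4 (λ a b c d → (a :+ b) :- (c :+ d) := (a :- c) :+ (b :- d)) refl
                    (F (s y)) (G (s y)) (F y) (G y)

  Δ^-sum : ∀ (s : A → A) m {N} (F : Fin N → A → ℤ) →
           Δ^ s m (λ x → sum (λ k → F k x)) ≗ (λ x → sum (λ k → Δ^ s m (F k) x))
  Δ^-sum s m {zero}  F = Δ^-zero s m (λ _ → refl)
  Δ^-sum s m {suc N} F x =
    trans (Δ^-+ s m (F zero) (λ y → sum (λ k → F (suc k) y)) x)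
          (cong (λ z → Δ^ s m (F zero) x ℤ.+ z) (Δ^-sum s m (F ∘ suc) x))

  Δ^-*-invariant : ∀ (s : A → A) m F K → K ∘ s ≗ K →
                   Δ^ s m (λ x → F x ℤ.* K x) ≗ (λ x → Δ^ s m F x ℤ.* K x)
  Δ^-*-invariant s zero    F K inv x = refl
  Δ^-*-invariant s (suc m) F K inv x =
    trans (Δ^-cong s m Δ-* x) (Δ^-*-invariant s m (Δ s F) K inv x)
    where
    Δ-* : ∀ y → Δ s (λ x → F x ℤ.* K x) y ≡ Δ s F y ℤ.* K y
    Δ-* y = trans (cong (λ k → F (s y) ℤ.* k ℤ.- F y ℤ.* K y) (inv y))
                  (solve 3 (λ a b k → a :* k :- b :* k := (a :- b) :* k) refl (F (s y)) (F y) (K y))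

  module _ (s : A → A) where
    private module ℚΔ = RationalDifferences s

    ι-Δ^ : ∀ m F x → ι (Δ^ s m F x) ≡ ℚΔ.Δ^ m (ι ∘ F) x
    ι-Δ^ zero    F x = refl
    ι-Δ^ (suc m) F x =
      trans (ι-Δ^ m (Δ s F) x) (ℚΔ.Δ^-cong m (λ y → ι-sub (F (s y)) (F y)) x)

    annihilated-ι : ∀ m F → ℚΔ.Annihilated m (ι ∘ F) → ∀ x → Δ^ s m F x ≡ + 0
    annihilated-ι m F ann x = ι-injective (trans (ι-Δ^ m F x) (ann x))

module BoxSums where

  open import Data.Nat as ℕ using (zero; suc; _<_)
  open import Data.Fin using (Fin; zero; suc; toℕ; fromℕ<)
  import Data.Fin.Properties as FinP
  open import Data.Vec using (Vec; []; _∷_)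
  import Data.Vec.Properties as VecP
  open import Data.Vec.Relation.Unary.All using (All; []; _∷_)
  open import Algebra.Bundles using (Monoid; CommutativeMonoid)
  import Algebra.Properties.Monoid.Sum as MonoidSum
  import Algebra.Properties.CommutativeMonoid.Sum as CommutativeMonoidSum
  open import Function using (_∘_)
  import Relation.Binary.PropositionalEquality as ≡
  open import Relation.Nullary using (yes; no)
  open import Data.Empty using (⊥-elim)

  module _ {c ℓ} (M : Monoid c ℓ) where

    open Monoid M
    open MonoidSum M using (sum; sum-cong-≋; sum-replicate-zero)
    open import Relation.Binary.Reasoning.Setoid setoid

    ∑box : ℕ → (m : ℕ) → (Vec ℕ m → Carrier) → Carrier
    ∑box N zero    f = f []
    ∑box N (suc m) f = sum (λ (k : Fin N) → ∑box N m (λ ks → f (toℕ k ∷ ks)))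

    ∑box-cong : ∀ N m {f g : Vec ℕ m → Carrier} →
                (∀ ks → All (_< N) ks → f ks ≈ g ks) → ∑box N m f ≈ ∑box N m g
    ∑box-cong N zero    f≈g = f≈g [] []
    ∑box-cong N (suc m) f≈g =
      sum-cong-≋ (λ k → ∑box-cong N m (λ ks ks<N → f≈g _ (FinP.toℕ<n k ∷ ks<N)))

    sum-ε : ∀ {N} (f : Fin N → Carrier) → (∀ k → f k ≈ ε) → sum f ≈ ε
    sum-ε {N} f f≈ε = trans (sum-cong-≋ f≈ε) (sum-replicate-zero N)

    ∑box-ε : ∀ N m (f : Vec ℕ m → Carrier) → (∀ ks → All (_< N) ks → f ks ≈ ε) → ∑box N m f ≈ ε
    ∑box-ε N zero    f f≈ε = f≈ε [] []
    ∑box-ε N (suc m) f f≈ε =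
      sum-ε _ (λ k → ∑box-ε N m _ (λ ks ks<N → f≈ε _ (FinP.toℕ<n k ∷ ks<N)))

    sum-single : ∀ {N} (f : Fin N → Carrier) i → (∀ k → k ≢ i → f k ≈ ε) → sum f ≈ f i
    sum-single f zero    f≈ε = trans (∙-cong refl (sum-ε _ (λ k → f≈ε (suc k) (λ ())))) (identityʳ _)
    sum-single f (suc i) f≈ε = begin
      f zero ∙ sum (f ∘ suc)
        ≈⟨ ∙-cong (f≈ε zero (λ ())) (sum-single (f ∘ suc) i (λ k k≢i → f≈ε (suc k) (k≢i ∘ FinP.suc-injective))) ⟩
      ε ∙ f (suc i)
        ≈⟨ identityˡ _ ⟩
      f (suc i) ∎

    ∑box-single : ∀ N m (f : Vec ℕ m → Carrier) ks → All (_< N) ks →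
                  (∀ js → All (_< N) js → js ≢ ks → f js ≈ ε) → ∑box N m f ≈ f ks
    ∑box-single N zero    f []       []           f≈ε = refl
    ∑box-single N (suc m) f (k ∷ ks) (k<N ∷ ks<N) f≈ε = begin
      ∑box N (suc m) f
        ≈⟨ sum-single _ i row≈ε ⟩
      ∑box N m (λ js → f (toℕ i ∷ js))
        ≈⟨ ∑box-single N m _ ks ks<N (λ js js<N js≢ks → f≈ε _ (toℕ<N ∷ js<N) (js≢ks ∘ VecP.∷-injectiveʳ)) ⟩
      f (toℕ i ∷ ks)
        ≡⟨ ≡.cong (λ j → f (j ∷ ks)) (FinP.toℕ-fromℕ< k<N) ⟩
      f (k ∷ ks) ∎
      where
      i = fromℕ< k<N
      toℕ<N = FinP.toℕ<n i
      row≈ε : ∀ j → j ≢ i → ∑box N m (λ js → f (toℕ j ∷ js)) ≈ ε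
      row≈ε j j≢i = ∑box-ε N m _ (λ js js<N → f≈ε _ (FinP.toℕ<n j ∷ js<N) (λ eq → j≢i
                      (FinP.toℕ-injective (≡.trans (VecP.∷-injectiveˡ eq) (≡.sym (FinP.toℕ-fromℕ< k<N))))))

    module _ {p} (P : Carrier → Set p) (P-resp : ∀ {x y} → x ≈ y → P x → P y)
             (P-ε : P ε) (P-∙ : ∀ {x y} → P x → P y → P (x ∙ y)) where

      sum-closed : ∀ {N} (f : Fin N → Carrier) → (∀ k → P (f k)) → P (sum f)
      sum-closed {zero}  f Pf = P-ε
      sum-closed {suc N} f Pf = P-∙ (Pf zero) (sum-closed (f ∘ suc) (Pf ∘ suc))

      ∑box-closed : ∀ N m (f : Vec ℕ m → Carrier) → (∀ ks → All (_< N) ks → P (f ks)) → P (∑box N m f)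
      ∑box-closed N zero    f Pf = Pf [] []
      ∑box-closed N (suc m) f Pf =
        sum-closed _ (λ k → ∑box-closed N m _ (λ ks ks<N → Pf _ (FinP.toℕ<n k ∷ ks<N)))

  module _ {c₁ ℓ₁ c₂ ℓ₂} (M₁ : Monoid c₁ ℓ₁) (M₂ : Monoid c₂ ℓ₂) where

    private
      module M₁ = Monoid M₁
      module M₂ = Monoid M₂
      module S₁ = MonoidSum M₁
      module S₂ = MonoidSum M₂

    module _ (φ : M₁.Carrier → M₂.Carrier) (φ-cong : ∀ {x y} → x M₁.≈ y → φ x M₂.≈ φ y)
             (φ-ε : φ M₁.ε M₂.≈ M₂.ε) (φ-∙ : ∀ x y → φ (x M₁.∙ y) M₂.≈ φ x M₂.∙ φ y) where

      sum-homo : ∀ {N} (f : Fin N → M₁.Carrier) → φ (S₁.sum f) M₂.≈ S₂.sum (φ ∘ f)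
      sum-homo {zero}  f = φ-ε
      sum-homo {suc N} f = M₂.trans (φ-∙ _ _) (M₂.∙-cong M₂.refl (sum-homo (f ∘ suc)))

      ∑box-homo : ∀ N m (f : Vec ℕ m → M₁.Carrier) → φ (∑box M₁ N m f) M₂.≈ ∑box M₂ N m (φ ∘ f)
      ∑box-homo N zero    f = M₂.refl
      ∑box-homo N (suc m) f =
        M₂.trans (sum-homo {N} (λ k → ∑box M₁ N m (λ ks → f (toℕ k ∷ ks))))
                 (S₂.sum-cong-≋ {N} (λ k → ∑box-homo N m (λ ks → f (toℕ k ∷ ks))))

  module _ {c ℓ} (M : CommutativeMonoid c ℓ) where

    open CommutativeMonoid M
    open CommutativeMonoidSum M using (sum-cong-≋; ∑-distrib-+)
    open import Relation.Binary.Reasoning.Setoid setoid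

    ∑box-∙ : ∀ N m (f g : Vec ℕ m → Carrier) →
             ∑box monoid N m (λ ks → f ks ∙ g ks) ≈ ∑box monoid N m f ∙ ∑box monoid N m g
    ∑box-∙ N zero    f g = refl
    ∑box-∙ N (suc m) f g =
      trans (sum-cong-≋ {N} (λ k → ∑box-∙ N m (λ ks → f (toℕ k ∷ ks)) (λ ks → g (toℕ k ∷ ks))))
            (∑-distrib-+ {N} (λ k → ∑box monoid N m (λ ks → f (toℕ k ∷ ks)))
                         (λ k → ∑box monoid N m (λ ks → g (toℕ k ∷ ks))))

    omit : ∀ {m} → Vec ℕ m → (Vec ℕ m → Carrier) → Vec ℕ m → Carrier
    omit ks f js with VecP.≡-dec ℕ._≟_ js ks
    ... | yes _ = ε
    ... | no  _ = f js

    omit-self : ∀ {m} (ks : Vec ℕ m) f → omit ks f ks ≈ ε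
    omit-self ks f with VecP.≡-dec ℕ._≟_ ks ks
    ... | yes _     = refl
    ... | no  ks≢ks = ⊥-elim (ks≢ks ≡.refl)

    omit-other : ∀ {m} (ks : Vec ℕ m) f js → js ≢ ks → omit ks f js ≈ f js
    omit-other ks f js js≢ks with VecP.≡-dec ℕ._≟_ js ks
    ... | yes js≡ks = ⊥-elim (js≢ks js≡ks)
    ... | no  _     = refl

    ∑box-extract : ∀ N m (f : Vec ℕ m → Carrier) ks → All (_< N) ks →
                   ∑box monoid N m f ≈ f ks ∙ ∑box monoid N m (omit ks f)
    ∑box-extract N m f ks ks<N = begin
      ∑box monoid N m f                                    ≈⟨ ∑box-cong monoid N m (λ js _ → split js) ⟩
      ∑box monoid N m (λ js → keep js ∙ omit ks f js)      ≈⟨ ∑box-∙ N m keep (omit ks f) ⟩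
      ∑box monoid N m keep ∙ ∑box monoid N m (omit ks f)   ≈⟨ ∙-cong (∑box-single monoid N m keep ks ks<N keep-ε) refl ⟩
      keep ks ∙ ∑box monoid N m (omit ks f)                ≈⟨ ∙-cong keep-self refl ⟩
      f ks ∙ ∑box monoid N m (omit ks f)                   ∎
      where
      keep : Vec ℕ m → Carrier
      keep js with VecP.≡-dec ℕ._≟_ js ks
      ... | yes _ = f js
      ... | no  _ = ε
      split : ∀ js → f js ≈ keep js ∙ omit ks f js
      split js with VecP.≡-dec ℕ._≟_ js ks
      ... | yes _ = sym (identityʳ _)
      ... | no  _ = sym (identityˡ _)
      keep-ε : ∀ js → All (_< N) js → js ≢ ks → keep js ≈ ε
      keep-ε js _ js≢ks with VecP.≡-dec ℕ._≟_ js ks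
      ... | yes js≡ks = ⊥-elim (js≢ks js≡ks)
      ... | no  _     = refl
      keep-self : keep ks ≈ f ks
      keep-self with VecP.≡-dec ℕ._≟_ ks ks
      ... | yes _     = refl
      ... | no  ks≢ks = ⊥-elim (ks≢ks ≡.refl)

module IntegerValued where

  open import Data.Nat as ℕ using (zero; suc; _≤_; _<_; z≤n; s≤s)
  import Data.Nat.Properties as ℕP
  open import Data.Integer as ℤ using ()
  import Data.Integer.Properties as ℤP
  open import Data.Rational as ℚ using (0ℚ; 1ℚ)
  import Data.Rational.Properties as ℚP
  open import Data.Fin as Fin using (Fin)
  open import Algebra.Bundles using (CommutativeMonoid)
  open import Data.Product using (_,_)
  open import Function using (_∘_)
  open import Relation.Binary.PropositionalEquality
  open import Relation.Nullary using (yes; no)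
  open import Data.Empty using (⊥-elim)
  open import Data.Rational.Solver using (module +-*-Solver)
  open +-*-Solver using (solve; _:+_; _:-_; _:=_)
  open Integers
  open IntegerDifferences

  degree : ∀ {n} → Poly n → ℕ
  degree (con q) = 0
  degree (var i) = 1
  degree (p ⊕ q) = degree p ℕ.⊔ degree q
  degree (p ⊛ q) = degree p ℕ.+ degree q

  module _ {n : ℕ} where

    infixl 6 _+ᵖ_

    _+ᵖ_ : Pt n → Pt n → Pt n
    (x +ᵖ y) j = x j ℤ.+ y j

    unit : Fin n → ℤ → Pt n
    unit i t j with i Fin.≟ j
    ... | yes _ = t
    ... | no  _ = + 0

    step : Fin n → Pt n → Pt n
    step i x = x +ᵖ unit i (+ 1)

    unit-self : ∀ i t → unit i t i ≡ t
    unit-self i t with i Fin.≟ i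
    ... | yes _   = refl
    ... | no  i≢i = ⊥-elim (i≢i refl)

    unit-other : ∀ i j t → i ≢ j → unit i t j ≡ + 0
    unit-other i j t i≢j with i Fin.≟ j
    ... | yes i≡j = ⊥-elim (i≢j i≡j)
    ... | no  _   = refl

    unit-zero : ∀ i j → unit i (+ 0) j ≡ + 0
    unit-zero i j with i Fin.≟ j
    ... | yes _ = refl
    ... | no  _ = refl

    unit-suc : ∀ i j t → unit i (t ℤ.+ + 1) j ≡ unit i t j ℤ.+ unit i (+ 1) j
    unit-suc i j t with i Fin.≟ j
    ... | yes _ = refl
    ... | no  _ = refl

    step-self : ∀ i x → step i x i ≡ x i ℤ.+ + 1
    step-self i x = cong (ℤ._+_ (x i)) (unit-self i (+ 1))

    step-other : ∀ i j x → i ≢ j → step i x j ≡ x j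
    step-other i j x i≢j = trans (cong (ℤ._+_ (x j)) (unit-other i j (+ 1) i≢j)) (ℤP.+-identityʳ (x j))

    degree-subst : ∀ {m} (P : Poly m) (σ : Fin m → Poly n) → (∀ j → degree (σ j) ≤ 1) →
                   degree (substP P σ) ≤ degree P
    degree-subst (con q) σ σ≤1 = z≤n
    degree-subst (var i) σ σ≤1 = σ≤1 i
    degree-subst (p ⊕ q) σ σ≤1 = ℕP.⊔-mono-≤ (degree-subst p σ σ≤1) (degree-subst q σ σ≤1)
    degree-subst (p ⊛ q) σ σ≤1 = ℕP.+-mono-≤ (degree-subst p σ σ≤1) (degree-subst q σ σ≤1)

    eval-annihilated : ∀ i P → RationalDifferences.Annihilated (step i) (suc (degree P)) (λ x → eval P (ι ∘ x))
    eval-annihilated i (con q) x = ℚP.+-inverseʳ q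
    eval-annihilated i (var j) x =
      trans (cong₂ ℚ._-_ (Δ-coordinate (step i x)) (Δ-coordinate x)) (ℚP.+-inverseʳ (ι (unit i (+ 1) j)))
      where
      Δ-coordinate : ∀ y → ι (step i y j) ℚ.- ι (y j) ≡ ι (unit i (+ 1) j)
      Δ-coordinate y = trans (cong (ℚ._- ι (y j)) (ι-+ (y j) (unit i (+ 1) j)))
                             (solve 2 (λ a b → (a :+ b) :- a := b) refl (ι (y j)) (ι (unit i (+ 1) j)))
    eval-annihilated i (p ⊕ q) =
      annihilated-+ (suc (degree p ℕ.⊔ degree q)) (λ x → eval p (ι ∘ x)) (λ x → eval q (ι ∘ x))
        (annihilated-≤ (λ x → eval p (ι ∘ x)) (s≤s (ℕP.m≤m⊔n (degree p) (degree q))) (eval-annihilated i p))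
        (annihilated-≤ (λ x → eval q (ι ∘ x)) (s≤s (ℕP.m≤n⊔m (degree p) (degree q))) (eval-annihilated i q))
      where open RationalDifferences (step i)
    eval-annihilated i (p ⊛ q) =
      annihilated-* (degree p) (degree q) (λ x → eval p (ι ∘ x)) (λ x → eval q (ι ∘ x))
        (eval-annihilated i p) (eval-annihilated i q)
      where open RationalDifferences (step i)

    fun-cong : ∀ (h : IntZ n) {x y} → (∀ j → x j ≡ y j) → fun h x ≡ fun h y
    fun-cong h {x} {y} x≗y =
      ι-injective (trans (isPoly h x) (trans (eval-cong (poly h) (cong ι ∘ x≗y)) (sym (isPoly h y))))

    fun-annihilated : ∀ i (h : IntZ n) {N} → degree (poly h) < N → ∀ x → Δ^ (step i) N (fun h) x ≡ + 0
    fun-annihilated i h {N} deg<N =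
      annihilated-ι (step i) N (fun h) (annihilated-cong N (sym ∘ isPoly h)
        (annihilated-≤ (λ x → eval (poly h) (ι ∘ x)) deg<N (eval-annihilated i (poly h))))
      where open RationalDifferences (step i)

    infixl 6 _+ᶻ_
    infixl 7 _*ᶻ_ _·ᶻ_

    _+ᶻ_ : IntZ n → IntZ n → IntZ n
    g +ᶻ h = mkIntZ (λ x → fun g x ℤ.+ fun h x) (poly g ⊕ poly h)
      (λ x → trans (ι-+ (fun g x) (fun h x)) (cong₂ ℚ._+_ (isPoly g x) (isPoly h x)))

    _*ᶻ_ : IntZ n → IntZ n → IntZ n
    g *ᶻ h = mkIntZ (λ x → fun g x ℤ.* fun h x) (poly g ⊛ poly h)
      (λ x → trans (ι-* (fun g x) (fun h x)) (cong₂ ℚ._*_ (isPoly g x) (isPoly h x)))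

    _·ᶻ_ : ℤ → IntZ n → IntZ n
    z ·ᶻ h = mkIntZ (λ x → z ℤ.* fun h x) (con (ι z) ⊛ poly h)
      (λ x → trans (ι-* z (fun h x)) (cong (ι z ℚ.*_) (isPoly h x)))

    0ᶻ : IntZ n
    0ᶻ = mkIntZ (λ _ → + 0) (con 0ℚ) (λ _ → refl)

    1ᶻ : IntZ n
    1ᶻ = mkIntZ (λ _ → + 1) (con 1ℚ) (λ _ → refl)

    infix 4 _≈ᶻ_

    _≈ᶻ_ : IntZ n → IntZ n → Set
    g ≈ᶻ h = ∀ x → fun g x ≡ fun h x

    IntZ-commutativeMonoid : CommutativeMonoid _ _
    IntZ-commutativeMonoid = record
      { Carrier = IntZ n ; _≈_ = _≈ᶻ_ ; _∙_ = _+ᶻ_ ; ε = 0ᶻ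
      ; isCommutativeMonoid = record
        { isMonoid = record
          { isSemigroup = record
            { isMagma = record
              { isEquivalence = record
                { refl = λ _ → refl ; sym = λ g≈h x → sym (g≈h x) ; trans = λ g≈h h≈k x → trans (g≈h x) (h≈k x) }
              ; ∙-cong = λ g≈g′ h≈h′ x → cong₂ ℤ._+_ (g≈g′ x) (h≈h′ x) }
            ; assoc = λ g h k x → ℤP.+-assoc (fun g x) (fun h x) (fun k x) }
          ; identity = (λ h x → ℤP.+-identityˡ (fun h x)) , (λ h x → ℤP.+-identityʳ (fun h x)) }
        ; comm = λ g h x → ℤP.+-comm (fun g x) (fun h x) } }

    -- The polynomial of h (x + eᵢ) - h x is that of h ∘ (translation by eᵢ) + (-1)·h.
    Δᶻ : Fin n → IntZ n → IntZ n
    Δᶻ i h = mkIntZ (Δ (step i) (fun h)) (poly (shiftZ (unit i (+ 1)) h +ᶻ ℤ.- + 1 ·ᶻ h))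
      (λ x → trans (cong (λ z → ι (fun h (step i x) ℤ.+ z)) (sym (ℤP.-1*i≡-i (fun h x))))
                   (isPoly (shiftZ (unit i (+ 1)) h +ᶻ ℤ.- + 1 ·ᶻ h) x))

    Δᶻ^ : Fin n → ℕ → IntZ n → IntZ n
    Δᶻ^ i zero    h = h
    Δᶻ^ i (suc k) h = Δᶻ^ i k (Δᶻ i h)

    fun-Δᶻ^ : ∀ i k h → fun (Δᶻ^ i k h) ≗ Δ^ (step i) k (fun h)
    fun-Δᶻ^ i zero    h x = refl
    fun-Δᶻ^ i (suc k) h x = fun-Δᶻ^ i k (Δᶻ i h) x

    degree-Δᶻ^ : ∀ i k h → degree (poly (Δᶻ^ i k h)) ≤ degree (poly h)
    degree-Δᶻ^ i zero    h = ℕP.≤-refl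
    degree-Δᶻ^ i (suc k) h = ℕP.≤-trans (degree-Δᶻ^ i k (Δᶻ i h))
      (ℕP.⊔-lub (degree-subst (poly h) _ (λ j → ℕP.⊔-lub ℕP.≤-refl z≤n)) ℕP.≤-refl)

    dilate : ℕ → IntZ n → IntZ n
    dilate D h = mkIntZ (λ x → fun h (λ j → + D ℤ.* x j)) (substP (poly h) (λ j → con (ι (+ D)) ⊛ var j))
      (λ x → trans (isPoly h (λ j → + D ℤ.* x j))
             (trans (eval-cong (poly h) (λ j → ι-* (+ D) (x j)))
                    (sym (eval-subst (poly h) (λ j → con (ι (+ D)) ⊛ var j) (ι ∘ x)))))

module Binomials where

  open import Data.Nat using (zero; suc; _<_; s≤s)
  import Data.Nat.Properties as ℕP
  open import Data.Integer as ℤ using (-[1+_])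
  import Data.Integer.Properties as ℤP
  open import Data.Integer.Solver using (module +-*-Solver)
  open import Data.Rational as ℚ using (ℚ; 0ℚ; 1ℚ)
  import Data.Rational.Properties as ℚP
  open import Data.Rational.Solver using (module +-*-Solver)
  open import Data.Fin using (Fin; zero; suc; toℕ)
  open import Algebra.Properties.Semiring.Sum ℤP.+-*-semiring using (sum; ∑-distrib-+; sum-cong-≗; sum-replicate-zero)
  open import Function using (_∘_)
  open import Relation.Binary.PropositionalEquality
  open import Algebra.Bundles using (AbelianGroup)
  open import Algebra.Properties.Group (AbelianGroup.group ℤP.+-0-abelianGroup)
    using () renaming (∙-cancelʳ to ℤ-cancelʳ)
  open Integers
  open IntegerDifferences
  private module ℤS = Data.Integer.Solver.+-*-Solver

  binom⁺ : ℕ → ℕ → ℤ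
  binom⁺ m       zero    = + 1
  binom⁺ zero    (suc k) = + 0
  binom⁺ (suc m) (suc k) = binom⁺ m (suc k) ℤ.+ binom⁺ m k

  -- binom⁻ m k is the binomial coefficient of -(m + 1) over k.
  binom⁻ : ℕ → ℕ → ℤ
  binom⁻ m       zero    = + 1
  binom⁻ zero    (suc k) = ℤ.- binom⁻ zero k
  binom⁻ (suc m) (suc k) = binom⁻ m (suc k) ℤ.- binom⁻ (suc m) k

  binom : ℤ → ℕ → ℤ
  binom (+ m)    = binom⁺ m
  binom -[1+ m ] = binom⁻ m

  binom-zero : ∀ t → binom t 0 ≡ + 1
  binom-zero (+ m)    = refl
  binom-zero -[1+ m ] = refl

  binom-pascal : ∀ t k → binom (succ t) (suc k) ≡ binom t (suc k) ℤ.+ binom t k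
  binom-pascal (+ m)           k = cong (λ z → binom⁺ z (suc k)) (ℕP.+-comm m 1)
  binom-pascal -[1+ zero ]     k = sym (ℤP.+-inverseˡ (binom⁻ zero k))
  binom-pascal -[1+ suc m ]    k = sym (ℤS.solve 2 (λ a b → (a ℤS.:- b) ℤS.:+ b ℤS.:= a) refl
                                                   (binom⁻ m (suc k)) (binom⁻ (suc m) k))

  binom-pascal⁻ : ∀ t k → binom t (suc k) ≡ binom (succ t) (suc k) ℤ.- binom t k
  binom-pascal⁻ t k = trans (ℤS.solve 2 (λ a b → a ℤS.:= (a ℤS.:+ b) ℤS.:- b) refl (binom t (suc k)) (binom t k))
                            (cong (ℤ._- binom t k) (sym (binom-pascal t k)))

  Δ-binom-zero : Δ succ (λ t → binom t 0) ≗ (λ _ → + 0)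
  Δ-binom-zero t = cong₂ ℤ._-_ (binom-zero (succ t)) (binom-zero t)

  Δ-binom-suc : ∀ k → Δ succ (λ t → binom t (suc k)) ≗ (λ t → binom t k)
  Δ-binom-suc k t = trans (cong (ℤ._- binom t (suc k)) (binom-pascal t k))
                          (ℤS.solve 2 (λ a b → a ℤS.:+ b ℤS.:- a ℤS.:= b) refl (binom t (suc k)) (binom t k))

  Δ^-binom-diagonal : ∀ k t → Δ^ succ k (λ t → binom t k) t ≡ + 1
  Δ^-binom-diagonal zero    t = binom-zero t
  Δ^-binom-diagonal (suc k) t = trans (Δ^-cong succ k (Δ-binom-suc k) t) (Δ^-binom-diagonal k t)

  Δ^-binom-high : ∀ j k t → k < j → Δ^ succ j (λ t → binom t k) t ≡ + 0
  Δ^-binom-high (suc j) zero    t _         = Δ^-zero succ j Δ-binom-zero t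
  Δ^-binom-high (suc j) (suc k) t (s≤s k<j) =
    trans (Δ^-cong succ j (Δ-binom-suc k) t) (Δ^-binom-high j k t k<j)

  private
    ι-suc-nonZero : ∀ k → ℚ.NonZero (ι (+ suc k))
    ι-suc-nonZero k = ℚ.≢-nonZero {ι (+ suc k)} (λ eq → ℕP.1+n≢0 {k} (ℤP.+-injective (ι-injective {+ suc k} {+ 0} eq)))

  recip : ℕ → ℚ
  recip k = ℚ.1/_ (ι (+ suc k)) {{ι-suc-nonZero k}}

  recip-inverse : ∀ k → ι (+ suc k) ℚ.* recip k ≡ 1ℚ
  recip-inverse k = ℚP.*-inverseʳ (ι (+ suc k)) {{ι-suc-nonZero k}}

  binomℚ : ℕ → ℚ → ℚ
  binomℚ zero    y = 1ℚ
  binomℚ (suc k) y = binomℚ k y ℚ.* (y ℚ.- ι (+ k)) ℚ.* recip k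

  ι-suc : ∀ k → ι (+ suc k) ≡ ι (+ k) ℚ.+ 1ℚ
  ι-suc k = trans (cong (λ z → ι (+ z)) (ℕP.+-comm 1 k)) (ι-+ (+ k) (+ 1))

  module _ where
    open Data.Rational.Solver.+-*-Solver

    recip-split : ∀ j → recip j ≡ recip (suc j) ℚ.+ recip j ℚ.* recip (suc j)
    recip-split j = begin
      r′
        ≡⟨ sym (ℚP.*-identityʳ r′) ⟩
      r′ ℚ.* 1ℚ
        ≡⟨ cong (r′ ℚ.*_) (sym (recip-inverse (suc j))) ⟩
      r′ ℚ.* (ι (+ suc (suc j)) ℚ.* r)
        ≡⟨ cong (λ z → r′ ℚ.* (z ℚ.* r)) (trans (ι-suc (suc j)) (cong (ℚ._+ 1ℚ) (ι-suc j))) ⟩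
      r′ ℚ.* ((u ℚ.+ 1ℚ ℚ.+ 1ℚ) ℚ.* r)
        ≡⟨ solve 3 (λ r′ u r → r′ :* ((u :+ con 1ℚ :+ con 1ℚ) :* r) := (r′ :* (u :+ con 1ℚ)) :* r :+ r′ :* r)
                 refl r′ u r ⟩
      (r′ ℚ.* (u ℚ.+ 1ℚ)) ℚ.* r ℚ.+ r′ ℚ.* r
        ≡⟨ cong (λ z → z ℚ.* r ℚ.+ r′ ℚ.* r)
                (trans (cong (r′ ℚ.*_) (sym (ι-suc j))) (trans (ℚP.*-comm r′ _) (recip-inverse j))) ⟩
      1ℚ ℚ.* r ℚ.+ r′ ℚ.* r
        ≡⟨ cong (ℚ._+ r′ ℚ.* r) (ℚP.*-identityˡ r) ⟩
      r ℚ.+ r′ ℚ.* r ∎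
      where
      open ≡-Reasoning
      r′ = recip j
      r  = recip (suc j)
      u  = ι (+ j)

    recip-zero : recip 0 ≡ 1ℚ
    recip-zero = trans (sym (ℚP.*-identityˡ (recip 0))) (recip-inverse 0)

    binomℚ-pascal : ∀ k y → binomℚ (suc k) (y ℚ.+ 1ℚ) ≡ binomℚ (suc k) y ℚ.+ binomℚ k y
    binomℚ-pascal zero y rewrite recip-zero =
      solve 1 (λ y → con 1ℚ :* ((y :+ con 1ℚ) :- con 0ℚ) :* con 1ℚ := con 1ℚ :* (y :- con 0ℚ) :* con 1ℚ :+ con 1ℚ) refl y
    binomℚ-pascal (suc j) y = begin
      binomℚ (suc j) (y ℚ.+ 1ℚ) ℚ.* (y ℚ.+ 1ℚ ℚ.- ι (+ suc j)) ℚ.* r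
        ≡⟨ cong₂ (λ a b → a ℚ.* (y ℚ.+ 1ℚ ℚ.- b) ℚ.* r) (binomℚ-pascal j y) (ι-suc j) ⟩
      (A ℚ.+ B) ℚ.* (y ℚ.+ 1ℚ ℚ.- (u ℚ.+ 1ℚ)) ℚ.* r
        ≡⟨ solve 6 (λ X r′ B y u r → (X :* r′ :+ B) :* (y :+ con 1ℚ :- (u :+ con 1ℚ)) :* r
                     := X :* r′ :* (y :- (u :+ con 1ℚ)) :* r :+ X :* (r :+ r′ :* r) :+ (B :* (y :- u) :- X) :* r)
                 refl X r′ B y u r ⟩
      A ℚ.* (y ℚ.- (u ℚ.+ 1ℚ)) ℚ.* r ℚ.+ X ℚ.* (r ℚ.+ r′ ℚ.* r) ℚ.+ (B ℚ.* (y ℚ.- u) ℚ.- X) ℚ.* r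
        ≡⟨ cong₂ (λ a b → A ℚ.* (y ℚ.- a) ℚ.* r ℚ.+ X ℚ.* b ℚ.+ (B ℚ.* (y ℚ.- u) ℚ.- X) ℚ.* r)
                 (sym (ι-suc j)) (sym (recip-split j)) ⟩
      A ℚ.* (y ℚ.- ι (+ suc j)) ℚ.* r ℚ.+ X ℚ.* r′ ℚ.+ (X ℚ.- X) ℚ.* r
        ≡⟨ cong (λ z → A ℚ.* (y ℚ.- ι (+ suc j)) ℚ.* r ℚ.+ X ℚ.* r′ ℚ.+ z ℚ.* r) (ℚP.+-inverseʳ X) ⟩
      A ℚ.* (y ℚ.- ι (+ suc j)) ℚ.* r ℚ.+ A ℚ.+ 0ℚ ℚ.* r
        ≡⟨ solve 3 (λ a b r → a :+ b :+ con 0ℚ :* r := a :+ b) refl (A ℚ.* (y ℚ.- ι (+ suc j)) ℚ.* r) A r ⟩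
      A ℚ.* (y ℚ.- ι (+ suc j)) ℚ.* r ℚ.+ A ∎
      where
      open ≡-Reasoning
      B  = binomℚ j y
      X  = B ℚ.* (y ℚ.- ι (+ j))
      A  = binomℚ (suc j) y
      r′ = recip j
      r  = recip (suc j)
      u  = ι (+ j)

    binomℚ-zero : ∀ k → binomℚ (suc k) 0ℚ ≡ 0ℚ
    binomℚ-zero zero    = solve 1 (λ r → con 1ℚ :* (con 0ℚ :- con 0ℚ) :* r := con 0ℚ) refl (recip 0)
    binomℚ-zero (suc k) = trans (cong (λ z → z ℚ.* (0ℚ ℚ.- ι (+ suc k)) ℚ.* recip (suc k)) (binomℚ-zero k))
                                (solve 2 (λ a r → con 0ℚ :* a :* r := con 0ℚ) refl (0ℚ ℚ.- ι (+ suc k)) (recip (suc k)))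

    binomℚ-pascal⁻ : ∀ k y → binomℚ (suc k) y ≡ binomℚ (suc k) (y ℚ.+ 1ℚ) ℚ.- binomℚ k y
    binomℚ-pascal⁻ k y = trans (solve 2 (λ a b → a := (a :+ b) :- b) refl (binomℚ (suc k) y) (binomℚ k y))
                               (cong (ℚ._- binomℚ k y) (sym (binomℚ-pascal k y)))

  ι-binom : ∀ k t → ι (binom t k) ≡ binomℚ k (ι t)
  ι-binom zero    t = cong ι (binom-zero t)
  ι-binom (suc k) = ℤ-induction (λ t → ι (binom t (suc k)) ≡ binomℚ (suc k) (ι t)) (sym (binomℚ-zero k)) up down
    where
    open ≡-Reasoning
    up : ∀ t → ι (binom t (suc k)) ≡ binomℚ (suc k) (ι t) → ι (binom (succ t) (suc k)) ≡ binomℚ (suc k) (ι (succ t))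
    up t hyp = begin
      ι (binom (succ t) (suc k))                  ≡⟨ cong ι (binom-pascal t k) ⟩
      ι (binom t (suc k) ℤ.+ binom t k)           ≡⟨ ι-+ (binom t (suc k)) (binom t k) ⟩
      ι (binom t (suc k)) ℚ.+ ι (binom t k)       ≡⟨ cong₂ ℚ._+_ hyp (ι-binom k t) ⟩
      binomℚ (suc k) (ι t) ℚ.+ binomℚ k (ι t)     ≡⟨ sym (binomℚ-pascal k (ι t)) ⟩
      binomℚ (suc k) (ι t ℚ.+ 1ℚ)                 ≡⟨ cong (binomℚ (suc k)) (sym (ι-+ t (+ 1))) ⟩
      binomℚ (suc k) (ι (succ t))                 ∎
    down : ∀ t → ι (binom (succ t) (suc k)) ≡ binomℚ (suc k) (ι (succ t)) → ι (binom t (suc k)) ≡ binomℚ (suc k) (ι t)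
    down t hyp = begin
      ι (binom t (suc k))                         ≡⟨ cong ι (binom-pascal⁻ t k) ⟩
      ι (binom (succ t) (suc k) ℤ.- binom t k)    ≡⟨ ι-sub (binom (succ t) (suc k)) (binom t k) ⟩
      ι (binom (succ t) (suc k)) ℚ.- ι (binom t k) ≡⟨ cong₂ ℚ._-_ hyp (ι-binom k t) ⟩
      binomℚ (suc k) (ι (succ t)) ℚ.- binomℚ k (ι t) ≡⟨ cong (λ z → binomℚ (suc k) z ℚ.- binomℚ k (ι t)) (ι-+ t (+ 1)) ⟩
      binomℚ (suc k) (ι t ℚ.+ 1ℚ) ℚ.- binomℚ k (ι t) ≡⟨ sym (binomℚ-pascal⁻ k (ι t)) ⟩
      binomℚ (suc k) (ι t)                        ∎

  binomPoly : ∀ {n} → Poly n → ℕ → Poly n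
  binomPoly v zero    = con 1ℚ
  binomPoly v (suc k) = binomPoly v k ⊛ (v ⊕ con (ℚ.- ι (+ k))) ⊛ con (recip k)

  eval-binomPoly : ∀ {n} (v : Poly n) k ρ → eval (binomPoly v k) ρ ≡ binomℚ k (eval v ρ)
  eval-binomPoly v zero    ρ = refl
  eval-binomPoly v (suc k) ρ = cong (λ z → z ℚ.* (eval v ρ ℚ.- ι (+ k)) ℚ.* recip k) (eval-binomPoly v k ρ)

  binomial : ∀ {n} → Fin n → ℕ → IntZ n
  binomial d k = mkIntZ (λ x → binom (x d) k) (binomPoly (var d) k)
                        (λ x → trans (ι-binom k (x d)) (sym (eval-binomPoly (var d) k (ι ∘ x))))

  ∑-binom-succ : ∀ N t (c : ℕ → ℤ) →
                 sum (λ (k : Fin (suc N)) → binom (succ t) (toℕ k) ℤ.* c (toℕ k)) ≡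
                 sum (λ (k : Fin (suc N)) → binom t (toℕ k) ℤ.* c (toℕ k)) ℤ.+
                 sum (λ (k : Fin N) → binom t (toℕ k) ℤ.* c (suc (toℕ k)))
  ∑-binom-succ N t c = begin
    binom (succ t) 0 ℤ.* c 0 ℤ.+ sum (λ (k : Fin N) → binom (succ t) (suc (toℕ k)) ℤ.* c (suc (toℕ k)))
      ≡⟨ cong₂ ℤ._+_ (cong (ℤ._* c 0) (trans (binom-zero (succ t)) (sym (binom-zero t))))
                     (trans (sum-cong-≗ {N} (λ k → trans (cong (ℤ._* c (suc (toℕ k))) (binom-pascal t (toℕ k)))
                                                          (ℤP.*-distribʳ-+ (c (suc (toℕ k))) (binom t (suc (toℕ k))) (binom t (toℕ k)))))
                            (∑-distrib-+ {N} f g)) ⟩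
    binom t 0 ℤ.* c 0 ℤ.+ (sum f ℤ.+ sum g)
      ≡⟨ sym (ℤP.+-assoc (binom t 0 ℤ.* c 0) (sum f) (sum g)) ⟩
    binom t 0 ℤ.* c 0 ℤ.+ sum f ℤ.+ sum g ∎
    where
    open ≡-Reasoning
    f g : Fin N → ℤ
    f k = binom t (suc (toℕ k)) ℤ.* c (suc (toℕ k))
    g k = binom t (toℕ k) ℤ.* c (suc (toℕ k))

  newton-interpolation : ∀ N (φ : ℤ → ℤ) → (∀ t → Δ^ succ N φ t ≡ + 0) →
           ∀ t → φ t ≡ sum (λ (k : Fin N) → binom t (toℕ k) ℤ.* Δ^ succ (toℕ k) φ (+ 0))
  newton-interpolation zero    φ ann t = ann t
  newton-interpolation (suc N) φ ann = ℤ-induction (λ t → φ t ≡ R t) base up down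
    where
    R D : ℤ → ℤ
    R t = sum (λ (k : Fin (suc N)) → binom t (toℕ k) ℤ.* Δ^ succ (toℕ k) φ (+ 0))
    D t = sum (λ (k : Fin N) → binom t (toℕ k) ℤ.* Δ^ succ (suc (toℕ k)) φ (+ 0))
    φ-succ : ∀ t → φ (succ t) ≡ φ t ℤ.+ D t
    φ-succ t = trans (ℤS.solve 2 (λ a b → a ℤS.:= b ℤS.:+ (a ℤS.:- b)) refl (φ (succ t)) (φ t))
                     (cong (ℤ._+_ (φ t)) (newton-interpolation N (Δ succ φ) ann t))
    R-succ : ∀ t → R (succ t) ≡ R t ℤ.+ D t
    R-succ t = ∑-binom-succ N t (λ k → Δ^ succ k φ (+ 0))
    base : φ (+ 0) ≡ R (+ 0)
    base = sym (trans (cong₂ ℤ._+_ (ℤP.*-identityˡ (φ (+ 0)))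
                                   (sum-cong-≗ {N} (λ k → ℤP.*-zeroˡ (Δ^ succ (suc (toℕ k)) φ (+ 0)))))
                      (trans (cong (ℤ._+_ (φ (+ 0))) (sum-replicate-zero N)) (ℤP.+-identityʳ (φ (+ 0)))))
    up : ∀ t → φ t ≡ R t → φ (succ t) ≡ R (succ t)
    up t φt≡Rt = trans (φ-succ t) (trans (cong (ℤ._+ D t) φt≡Rt) (sym (R-succ t)))
    down : ∀ t → φ (succ t) ≡ R (succ t) → φ t ≡ R t
    down t eq = ℤ-cancelʳ (D t) (φ t) (R t) (trans (sym (φ-succ t)) (trans eq (R-succ t)))

module NewtonExpansion where

  open import Data.Nat using (zero; suc; _<_)
  import Data.Nat.Properties as ℕP
  open import Data.Integer as ℤ using ()
  import Data.Integer.Properties as ℤP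
  open import Data.Integer.Solver using (module +-*-Solver)
  open +-*-Solver using (solve; _:+_; _:=_)
  open import Data.Fin using (Fin; zero; suc; toℕ)
  open import Data.Vec using (Vec; []; _∷_; allFin; tabulate)
  open import Algebra.Bundles using (CommutativeMonoid; Monoid)
  open import Algebra.Properties.Semiring.Sum ℤP.+-*-semiring using (sum; sum-cong-≗)
  open import Function using (_∘_; id)
  open import Relation.Binary.PropositionalEquality
  open Integers using (succ)
  open IntegerDifferences
  open IntegerValued
  open Binomials
  open BoxSums

  ℤ-monoid : Monoid _ _
  ℤ-monoid = CommutativeMonoid.monoid ℤP.+-0-commutativeMonoid

  ∑boxℤ : ℕ → (m : ℕ) → (Vec ℕ m → ℤ) → ℤ
  ∑boxℤ = ∑box ℤ-monoid

  *-distribˡ-∑boxℤ : ∀ c N m (f : Vec ℕ m → ℤ) → c ℤ.* ∑boxℤ N m f ≡ ∑boxℤ N m (λ ks → c ℤ.* f ks)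
  *-distribˡ-∑boxℤ c N m f = ∑box-homo ℤ-monoid ℤ-monoid (c ℤ.*_) (cong (c ℤ.*_)) (ℤP.*-zeroʳ c)
                                       (ℤP.*-distribˡ-+ c) N m f

  module _ {n : ℕ} where

    ΔAlong : ∀ {m} → Vec (Fin n) m → Vec ℕ m → IntZ n → IntZ n
    ΔAlong []       []       h = h
    ΔAlong (d ∷ ds) (k ∷ ks) h = ΔAlong ds ks (Δᶻ^ d k h)

    binomialsAlong : ∀ {m} → Vec (Fin n) m → Vec ℕ m → IntZ n
    binomialsAlong []       []       = 1ᶻ
    binomialsAlong (d ∷ ds) (k ∷ ks) = binomial d k *ᶻ binomialsAlong ds ks

    translateAlong : ∀ {m} → Vec (Fin n) m → Pt n → Pt n → Pt n
    translateAlong []       l x = x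
    translateAlong (d ∷ ds) l x = translateAlong ds l x +ᵖ unit d (l d)

    Δ^-along-line : ∀ d k (h : IntZ n) y → Δ^ succ k (λ s → fun h (y +ᵖ unit d s)) ≗ (λ s → fun (Δᶻ^ d k h) (y +ᵖ unit d s))
    Δ^-along-line d zero    h y s = refl
    Δ^-along-line d (suc k) h y s =
      trans (Δ^-cong succ k (λ s → cong (ℤ._- fun h (y +ᵖ unit d s)) (fun-cong h (λ j →
               trans (cong (ℤ._+_ (y j)) (unit-suc d j s)) (sym (ℤP.+-assoc (y j) _ _))))) s)
            (Δ^-along-line d k (Δᶻ d h) y s)

    newton-line : ∀ d N (h : IntZ n) → degree (poly h) < N → ∀ y t →
                  fun h (y +ᵖ unit d t) ≡ sum (λ (k : Fin N) → binom t (toℕ k) ℤ.* fun (Δᶻ^ d (toℕ k) h) y)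
    newton-line d N h deg<N y t =
      trans (newton-interpolation N (λ s → fun h (y +ᵖ unit d s)) annihilated t)
            (sum-cong-≗ {N} (λ k → cong (binom t (toℕ k) ℤ.*_) (trans (Δ^-along-line d (toℕ k) h y (+ 0))
              (fun-cong (Δᶻ^ d (toℕ k) h) (λ j → trans (cong (ℤ._+_ (y j)) (unit-zero d j)) (ℤP.+-identityʳ (y j)))))))
      where
      annihilated : ∀ s → Δ^ succ N (λ s → fun h (y +ᵖ unit d s)) s ≡ + 0
      annihilated s = trans (Δ^-along-line d N h y s)
                            (trans (fun-Δᶻ^ d N h _) (fun-annihilated d h deg<N _))

    newton-along : ∀ {m} (ds : Vec (Fin n) m) N (h : IntZ n) → degree (poly h) < N → ∀ x l →
                   fun h (translateAlong ds l x) ≡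
                   ∑boxℤ N m (λ ks → fun (binomialsAlong ds ks) l ℤ.* fun (ΔAlong ds ks h) x)
    newton-along []       N h deg<N x l = sym (ℤP.*-identityˡ (fun h x))
    newton-along {suc m} (d ∷ ds) N h deg<N x l = begin
      fun h (translateAlong ds l x +ᵖ unit d (l d))
        ≡⟨ newton-line d N h deg<N (translateAlong ds l x) (l d) ⟩
      sum (λ (k : Fin N) → binom (l d) (toℕ k) ℤ.* fun (Δᶻ^ d (toℕ k) h) (translateAlong ds l x))
        ≡⟨ sum-cong-≗ {N} (λ k → cong (binom (l d) (toℕ k) ℤ.*_)
             (newton-along ds N (Δᶻ^ d (toℕ k) h) (ℕP.≤-<-trans (degree-Δᶻ^ d (toℕ k) h) deg<N) x l)) ⟩
      sum (λ (k : Fin N) → binom (l d) (toℕ k) ℤ.* ∑boxℤ N _ (λ ks → fun (binomialsAlong ds ks) l ℤ.* fun (ΔAlong ds ks (Δᶻ^ d (toℕ k) h)) x))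
        ≡⟨ sum-cong-≗ {N} (λ k → trans (*-distribˡ-∑boxℤ (binom (l d) (toℕ k)) N m _)
             (∑box-cong ℤ-monoid N m (λ ks _ → sym (ℤP.*-assoc (binom (l d) (toℕ k)) _ _)))) ⟩
      ∑boxℤ N _ (λ ks → fun (binomialsAlong (d ∷ ds) ks) l ℤ.* fun (ΔAlong (d ∷ ds) ks h) x) ∎
      where open ≡-Reasoning

    translateAlong-tabulate : ∀ {m} (g : Fin m → Fin n) l x j →
                              translateAlong (tabulate g) l x j ≡ x j ℤ.+ sum (λ i → unit (g i) (l (g i)) j)
    translateAlong-tabulate {zero}  g l x j = sym (ℤP.+-identityʳ (x j))
    translateAlong-tabulate {suc m} g l x j =
      trans (cong (ℤ._+ unit (g zero) (l (g zero)) j) (translateAlong-tabulate (g ∘ suc) l x j))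
            (solve 3 (λ a s u → a :+ s :+ u := a :+ (u :+ s)) refl (x j) _ (unit (g zero) (l (g zero)) j))

    translateAlong-allFin : ∀ l x j → translateAlong (allFin n) l x j ≡ x j ℤ.+ l j
    translateAlong-allFin l x j =
      trans (translateAlong-tabulate id l x j)
            (cong (ℤ._+_ (x j)) (trans (sum-single ℤ-monoid (λ i → unit i (l i) j) j
                                          (λ i i≢j → unit-other i j (l i) i≢j))
                                        (unit-self j (l j))))

    basis : Vec ℕ n → IntZ n
    basis = binomialsAlong (allFin n)

    Δᴷ : Vec ℕ n → IntZ n → IntZ n
    Δᴷ = ΔAlong (allFin n)

    coefficient : Vec ℕ n → IntZ n → ℤ
    coefficient ks h = fun (Δᴷ ks h) (λ _ → + 0)

    translation-expansion : ∀ N (h : IntZ n) → degree (poly h) < N → ∀ x l →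
                            fun h (x +ᵖ l) ≡ ∑boxℤ N n (λ ks → fun (basis ks) l ℤ.* fun (Δᴷ ks h) x)
    translation-expansion N h deg<N x l =
      trans (fun-cong h (λ j → sym (translateAlong-allFin l x j))) (newton-along (allFin n) N h deg<N x l)

    basis-expansion : ∀ N (h : IntZ n) → degree (poly h) < N → ∀ l →
                      fun h l ≡ ∑boxℤ N n (λ ks → coefficient ks h ℤ.* fun (basis ks) l)
    basis-expansion N h deg<N l =
      trans (fun-cong h (λ j → sym (ℤP.+-identityˡ (l j))))
            (trans (translation-expansion N h deg<N (λ _ → + 0) l)
                   (∑box-cong ℤ-monoid N n (λ ks _ → ℤP.*-comm (fun (basis ks) l) (coefficient ks h))))

    ΔAlong-cong : ∀ {m} (ds : Vec (Fin n) m) ks {g h} → g ≈ᶻ h → ΔAlong ds ks g ≈ᶻ ΔAlong ds ks h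
    ΔAlong-cong []       []       g≈h = g≈h
    ΔAlong-cong (d ∷ ds) (k ∷ ks) {g} {h} g≈h = ΔAlong-cong ds ks (λ x →
      trans (fun-Δᶻ^ d k g x) (trans (Δ^-cong (step d) k g≈h x) (sym (fun-Δᶻ^ d k h x))))

    ΔAlong-0 : ∀ {m} (ds : Vec (Fin n) m) ks → ΔAlong ds ks 0ᶻ ≈ᶻ 0ᶻ
    ΔAlong-0 []       []       x = refl
    ΔAlong-0 (d ∷ ds) (k ∷ ks) x = trans (ΔAlong-cong ds ks (λ y →
      trans (fun-Δᶻ^ d k 0ᶻ y) (Δ^-zero (step d) k (λ _ → refl) y)) x) (ΔAlong-0 ds ks x)

    ΔAlong-+ : ∀ {m} (ds : Vec (Fin n) m) ks g h → ΔAlong ds ks (g +ᶻ h) ≈ᶻ ΔAlong ds ks g +ᶻ ΔAlong ds ks h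
    ΔAlong-+ []       []       g h x = refl
    ΔAlong-+ (d ∷ ds) (k ∷ ks) g h x = trans (ΔAlong-cong ds ks (λ y →
      trans (fun-Δᶻ^ d k (g +ᶻ h) y) (trans (Δ^-+ (step d) k (fun g) (fun h) y)
        (sym (cong₂ ℤ._+_ (fun-Δᶻ^ d k g y) (fun-Δᶻ^ d k h y))))) x) (ΔAlong-+ ds ks (Δᶻ^ d k g) (Δᶻ^ d k h) x)

    ΔAlong-· : ∀ {m} (ds : Vec (Fin n) m) ks c h → ΔAlong ds ks (c ·ᶻ h) ≈ᶻ c ·ᶻ ΔAlong ds ks h
    ΔAlong-· []       []       c h x = refl
    ΔAlong-· (d ∷ ds) (k ∷ ks) c h x = trans (ΔAlong-cong ds ks (λ y →
      trans (fun-Δᶻ^ d k (c ·ᶻ h) y) (trans (Δ^-cong (step d) k (λ z → ℤP.*-comm c (fun h z)) y)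
        (trans (Δ^-*-invariant (step d) k (fun h) (λ _ → c) (λ _ → refl) y)
               (trans (ℤP.*-comm _ c) (cong (c ℤ.*_) (sym (fun-Δᶻ^ d k h y))))))) x) (ΔAlong-· ds ks c (Δᶻ^ d k h) x)

  IntZ-monoid : ℕ → Monoid _ _
  IntZ-monoid n = CommutativeMonoid.monoid (IntZ-commutativeMonoid {n})

  ∑boxᶻ : ∀ {n} → ℕ → (m : ℕ) → (Vec ℕ m → IntZ n) → IntZ n
  ∑boxᶻ {n} = ∑box (IntZ-monoid n)

  fun-∑boxᶻ : ∀ {n} N m (F : Vec ℕ m → IntZ n) x → fun (∑boxᶻ N m F) x ≡ ∑boxℤ N m (λ ks → fun (F ks) x)
  fun-∑boxᶻ {n} N m F x = ∑box-homo (IntZ-monoid n) ℤ-monoid (λ g → fun g x) (λ g≈h → g≈h x) refl (λ _ _ → refl) N m F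

  ≈ᶻ-∑boxᶻ : ∀ {n} N m (h : IntZ n) (c : Vec ℕ m → ℤ) (G : Vec ℕ m → IntZ n) →
             (∀ x → fun h x ≡ ∑boxℤ N m (λ ks → c ks ℤ.* fun (G ks) x)) → h ≈ᶻ ∑boxᶻ N m (λ ks → c ks ·ᶻ G ks)
  ≈ᶻ-∑boxᶻ N m h c G h≡ x = trans (h≡ x) (sym (fun-∑boxᶻ N m (λ ks → c ks ·ᶻ G ks) x))

  coefficient-∑boxᶻ : ∀ {n} js N m (c : Vec ℕ m → ℤ) (G : Vec ℕ m → IntZ n) →
                      coefficient js (∑boxᶻ N m (λ ks → c ks ·ᶻ G ks)) ≡ ∑boxℤ N m (λ ks → c ks ℤ.* coefficient js (G ks))
  coefficient-∑boxᶻ {n} js N m c G =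
    trans (∑box-homo (IntZ-monoid n) ℤ-monoid (coefficient js) (λ g≈h → ΔAlong-cong (allFin n) js g≈h _)
                     (ΔAlong-0 (allFin n) js _) (λ g h → ΔAlong-+ (allFin n) js g h _) N m _)
          (∑box-cong ℤ-monoid N m (λ ks _ → ΔAlong-· (allFin n) js (c ks) (G ks) _))

module DilatedBasis where

  open import Data.Nat using (zero; suc; _≤_; _<_)
  import Data.Nat.Properties as ℕP
  open import Data.Integer as ℤ using ()
  import Data.Integer.Properties as ℤP
  open import Data.Integer.Solver using (module +-*-Solver)
  open +-*-Solver using (solve; _:+_; _:-_; _:*_; _:=_; con)
  open import Data.Fin using (Fin; zero; suc; toℕ)
  open import Data.Vec as Vec using (Vec; []; _∷_; allFin; zipWith)
  open import Data.Vec.Relation.Unary.All as All using (All; []; _∷_)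
  open import Data.Vec.Relation.Unary.AllPairs using (AllPairs; []; _∷_)
  import Data.Vec.Relation.Unary.AllPairs.Properties as AllPairsP
  open import Data.Vec.Relation.Binary.Pointwise.Inductive using (Pointwise; []; _∷_)
  open import Algebra.Properties.Semiring.Sum ℤP.+-*-semiring using (sum; sum-cong-≗)
  open import Function using (_∘_; id)
  open import Relation.Binary.PropositionalEquality
  open import Relation.Nullary using (yes; no; ¬_)
  open import Data.Empty using (⊥-elim)
  open Integers using (succ)
  open IntegerDifferences
  open IntegerValued
  open Binomials
  open BoxSums
  open NewtonExpansion

  telescope : ∀ D (F : ℤ → ℤ) a → F (a ℤ.+ + D) ℤ.- F a ≡ sum (λ (s : Fin D) → Δ succ F (a ℤ.+ + toℕ s))
  telescope zero    F a = trans (cong (λ z → F z ℤ.- F a) (ℤP.+-identityʳ a)) (ℤP.+-inverseʳ (F a))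
  telescope (suc D) F a = begin
    F (a ℤ.+ + suc D) ℤ.- F a
      ≡⟨ solve 3 (λ x y z → x :- z := (y :- z) :+ (x :- y)) refl (F (a ℤ.+ + suc D)) (F (succ a)) (F a) ⟩
    Δ succ F a ℤ.+ (F (a ℤ.+ + suc D) ℤ.- F (succ a))
      ≡⟨ cong₂ ℤ._+_ (cong (Δ succ F) (sym (ℤP.+-identityʳ a)))
                     (trans (cong (λ z → F z ℤ.- F (succ a)) (sym (ℤP.+-assoc a (+ 1) (+ D)))) (telescope D F (succ a))) ⟩
    Δ succ F (a ℤ.+ + 0) ℤ.+ sum (λ (s : Fin D) → Δ succ F (succ a ℤ.+ + toℕ s))
      ≡⟨ cong (ℤ._+_ (Δ succ F (a ℤ.+ + 0))) (sum-cong-≗ {D} (λ s → cong (Δ succ F) (ℤP.+-assoc a (+ 1) (+ toℕ s)))) ⟩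
    sum (λ (s : Fin (suc D)) → Δ succ F (a ℤ.+ + toℕ s)) ∎
    where open ≡-Reasoning

  ∑boxℤ-const : ∀ N m c → ∑boxℤ N m (λ _ → c) ≡ (+ N) ℤ.^ m ℤ.* c
  ∑boxℤ-const N zero    c = sym (ℤP.*-identityˡ c)
  ∑boxℤ-const N (suc m) c =
    trans (sum-cong-≗ {N} (λ _ → ∑boxℤ-const N m c))
          (trans (sum-const N) (sym (ℤP.*-assoc (+ N) ((+ N) ℤ.^ m) c)))
    where
    sum-const : ∀ N {a} → sum (λ (_ : Fin N) → a) ≡ + N ℤ.* a
    sum-const zero    {a} = sym (ℤP.*-zeroˡ a)
    sum-const (suc N) {a} = trans (cong (ℤ._+_ a) (sum-const N))
      (solve 2 (λ a b → a :+ b :* a := (con (+ 1) :+ b) :* a) refl a (+ N))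

  -- The D-fold dilation spreads one difference step over D consecutive ones.
  Δ^-dilate : ∀ D j (F : ℤ → ℤ) t → Δ^ succ j (λ u → F (+ D ℤ.* u)) t ≡
              ∑boxℤ D j (λ ss → Δ^ succ j F (+ D ℤ.* t ℤ.+ + Vec.sum ss))
  Δ^-dilate D zero    F t = cong F (sym (ℤP.+-identityʳ _))
  Δ^-dilate D (suc j) F t = begin
    Δ^ succ j (Δ succ (λ u → F (+ D ℤ.* u))) t
      ≡⟨ Δ^-cong succ j (λ u → trans (cong (λ z → F z ℤ.- F (+ D ℤ.* u))
                                       (trans (ℤP.*-distribˡ-+ (+ D) u (+ 1)) (cong (ℤ._+_ (+ D ℤ.* u)) (ℤP.*-identityʳ (+ D)))))
                                     (telescope D F (+ D ℤ.* u))) t ⟩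
    Δ^ succ j (λ u → sum (λ (s : Fin D) → Δ succ F (+ D ℤ.* u ℤ.+ + toℕ s))) t
      ≡⟨ Δ^-sum succ j {D} (λ s u → Δ succ F (+ D ℤ.* u ℤ.+ + toℕ s)) t ⟩
    sum (λ (s : Fin D) → Δ^ succ j (λ u → Δ succ F (+ D ℤ.* u ℤ.+ + toℕ s)) t)
      ≡⟨ sum-cong-≗ {D} (λ s → trans (Δ^-dilate D j (λ v → Δ succ F (v ℤ.+ + toℕ s)) t)
           (∑box-cong ℤ-monoid D j (λ ss _ → trans (Δ^-∘ (shift-succ (+ toℕ s)) j (Δ succ F) _)
             (cong (Δ^ succ (suc j) F) (solve 3 (λ a w s → a :+ w :+ s := a :+ (s :+ w)) refl
                                                  (+ D ℤ.* t) (+ Vec.sum ss) (+ toℕ s)))))) ⟩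
    ∑boxℤ D (suc j) (λ ss → Δ^ succ (suc j) F (+ D ℤ.* t ℤ.+ + Vec.sum ss)) ∎
    where
    open ≡-Reasoning
    shift-succ : ∀ c x → succ x ℤ.+ c ≡ succ (x ℤ.+ c)
    shift-succ c x = solve 2 (λ x c → x :+ con (+ 1) :+ c := x :+ c :+ con (+ 1)) refl x c

  dilatedBinom : ℕ → ℕ → ℤ → ℤ
  dilatedBinom D k t = binom (+ D ℤ.* t) k

  Δ^-dilatedBinom-diagonal : ∀ D k t → Δ^ succ k (dilatedBinom D k) t ≡ (+ D) ℤ.^ k
  Δ^-dilatedBinom-diagonal D k t =
    trans (Δ^-dilate D k (λ v → binom v k) t)
          (trans (∑box-cong ℤ-monoid D k (λ _ _ → Δ^-binom-diagonal k _))
                 (trans (∑boxℤ-const D k (+ 1)) (ℤP.*-identityʳ ((+ D) ℤ.^ k))))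

  Δ^-dilatedBinom-high : ∀ D j k t → k < j → Δ^ succ j (dilatedBinom D k) t ≡ + 0
  Δ^-dilatedBinom-high D j k t k<j =
    trans (Δ^-dilate D j (λ v → binom v k) t)
          (trans (∑box-cong ℤ-monoid D j (λ _ _ → Δ^-binom-high j k _ k<j))
                 (trans (∑boxℤ-const D j (+ 0)) (ℤP.*-zeroʳ ((+ D) ℤ.^ j))))

  module _ {n : ℕ} where

    prodAlong : ∀ {m} → Vec (Fin n) m → Vec (ℤ → ℤ) m → Pt n → ℤ
    prodAlong []       []       x = + 1
    prodAlong (d ∷ ds) (ψ ∷ ψs) x = ψ (x d) ℤ.* prodAlong ds ψs x

    prodAlong-invariant : ∀ {m} d (ds : Vec (Fin n) m) ψs → All (d ≢_) ds →
                          prodAlong ds ψs ∘ step d ≗ prodAlong ds ψs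
    prodAlong-invariant d []        []       []              x = refl
    prodAlong-invariant d (d′ ∷ ds) (ψ ∷ ψs) (d≢d′ ∷ d∉ds) x =
      cong₂ ℤ._*_ (cong ψ (step-other d d′ x d≢d′)) (prodAlong-invariant d ds ψs d∉ds x)

    ΔAlong-prodAlong : ∀ {m} (ds : Vec (Fin n) m) js ψs → AllPairs _≢_ ds →
                       (C : Pt n → ℤ) → All (λ d → C ∘ step d ≗ C) ds →
                       ∀ H → (∀ x → fun H x ≡ C x ℤ.* prodAlong ds ψs x) →
                       ∀ x → fun (ΔAlong ds js H) x ≡ C x ℤ.* prodAlong ds (zipWith (Δ^ succ) js ψs) x
    ΔAlong-prodAlong []       []       []       []                C _ H H≡ = H≡
    ΔAlong-prodAlong (d ∷ ds) (j ∷ js) (ψ ∷ ψs) (d∉ds ∷ distinct) C (C-inv ∷ C-invs) H H≡ x =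
      trans (ΔAlong-prodAlong ds js ψs distinct C′ (C′-invariant ds d∉ds C-invs) (Δᶻ^ d j H) ΔH≡ x)
            (ℤP.*-assoc (C x) (Δ^ succ j ψ (x d)) _)
      where
      C′ K : Pt n → ℤ
      C′ y = C y ℤ.* Δ^ succ j ψ (y d)
      K y = C y ℤ.* prodAlong ds ψs y
      ΔH≡ : ∀ y → fun (Δᶻ^ d j H) y ≡ C′ y ℤ.* prodAlong ds ψs y
      ΔH≡ y = begin
        fun (Δᶻ^ d j H) y                               ≡⟨ fun-Δᶻ^ d j H y ⟩
        Δ^ (step d) j (fun H) y                         ≡⟨ Δ^-cong (step d) j (λ z → trans (H≡ z)
                                                             (solve 3 (λ c a p → c :* (a :* p) := a :* (c :* p)) refl
                                                                      (C z) (ψ (z d)) (prodAlong ds ψs z))) y ⟩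
        Δ^ (step d) j (λ z → ψ (z d) ℤ.* K z) y         ≡⟨ Δ^-*-invariant (step d) j (λ z → ψ (z d)) K
                                                             (λ z → cong₂ ℤ._*_ (C-inv z) (prodAlong-invariant d ds ψs d∉ds z)) y ⟩
        Δ^ (step d) j (λ z → ψ (z d)) y ℤ.* K y         ≡⟨ cong (ℤ._* K y) (Δ^-∘ (step-self d) j ψ y) ⟩
        Δ^ succ j ψ (y d) ℤ.* K y                       ≡⟨ solve 3 (λ a c p → a :* (c :* p) := c :* a :* p) refl
                                                             (Δ^ succ j ψ (y d)) (C y) (prodAlong ds ψs y) ⟩
        C′ y ℤ.* prodAlong ds ψs y                      ∎
        where open ≡-Reasoning
      C′-invariant : ∀ {m} (ds : Vec (Fin n) m) → All (d ≢_) ds → All (λ d′ → C ∘ step d′ ≗ C) ds →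
                     All (λ d′ → C′ ∘ step d′ ≗ C′) ds
      C′-invariant []        []              []                = []
      C′-invariant (d′ ∷ ds) (d≢d′ ∷ d∉ds) (C-inv′ ∷ C-invs) =
        (λ z → cong₂ ℤ._*_ (C-inv′ z) (cong (Δ^ succ j ψ) (step-other d′ d z (d≢d′ ∘ sym))))
        ∷ C′-invariant ds d∉ds C-invs

  dilationEntry : ∀ {m} → ℕ → Vec ℕ m → Vec ℕ m → ℤ
  dilationEntry D []       []       = + 1
  dilationEntry D (j ∷ js) (k ∷ ks) = Δ^ succ j (dilatedBinom D k) (+ 0) ℤ.* dilationEntry D js ks

  coefficient-dilate-basis : ∀ {n} D (js ks : Vec ℕ n) → coefficient js (dilate D (basis ks)) ≡ dilationEntry D js ks
  coefficient-dilate-basis {n} D js ks =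
    trans (ΔAlong-prodAlong (allFin n) js (Vec.map (dilatedBinom D) ks) (AllPairsP.tabulate⁺ id) (λ _ → + 1)
                            (All.universal (λ _ _ → refl) (allFin n)) (dilate D (basis ks))
                            (λ x → trans (fun-dilate-binomialsAlong (allFin n) ks x) (sym (ℤP.*-identityˡ _))) (λ _ → + 0))
          (trans (ℤP.*-identityˡ _) (prodAlong-origin (allFin n) js ks))
    where
    fun-dilate-binomialsAlong : ∀ {m} (ds : Vec (Fin n) m) ks x →
                                fun (dilate D (binomialsAlong ds ks)) x ≡ prodAlong ds (Vec.map (dilatedBinom D) ks) x
    fun-dilate-binomialsAlong []       []       x = refl
    fun-dilate-binomialsAlong (d ∷ ds) (k ∷ ks) x =
      cong (dilatedBinom D k (x d) ℤ.*_) (fun-dilate-binomialsAlong ds ks x)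
    prodAlong-origin : ∀ {m} (ds : Vec (Fin n) m) js ks →
                       prodAlong ds (zipWith (Δ^ succ) js (Vec.map (dilatedBinom D) ks)) (λ _ → + 0) ≡ dilationEntry D js ks
    prodAlong-origin []       []       []       = refl
    prodAlong-origin (d ∷ ds) (j ∷ js) (k ∷ ks) = cong (Δ^ succ j (dilatedBinom D k) (+ 0) ℤ.*_) (prodAlong-origin ds js ks)

  dilationEntry-high : ∀ {m} D (js ks : Vec ℕ m) → ¬ Pointwise _≤_ js ks → dilationEntry D js ks ≡ + 0
  dilationEntry-high D []       []       js≰ks = ⊥-elim (js≰ks [])
  dilationEntry-high D (j ∷ js) (k ∷ ks) js≰ks with j ℕP.≤? k
  ... | yes j≤k = trans (cong (Δ^ succ j (dilatedBinom D k) (+ 0) ℤ.*_) (dilationEntry-high D js ks (js≰ks ∘ (j≤k ∷_))))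
                        (ℤP.*-zeroʳ (Δ^ succ j (dilatedBinom D k) (+ 0)))
  ... | no  j≰k = trans (cong (ℤ._* dilationEntry D js ks) (Δ^-dilatedBinom-high D j k (+ 0) (ℕP.≰⇒> j≰k)))
                        (ℤP.*-zeroˡ (dilationEntry D js ks))

  dilationEntry-diagonal : ∀ {m} D (ks : Vec ℕ m) → dilationEntry D ks ks ≡ (+ D) ℤ.^ Vec.sum ks
  dilationEntry-diagonal D []       = refl
  dilationEntry-diagonal D (k ∷ ks) =
    trans (cong₂ ℤ._*_ (Δ^-dilatedBinom-diagonal D k (+ 0)) (dilationEntry-diagonal D ks))
          (sym (ℤP.^-distribˡ-+-* (+ D) k (Vec.sum ks)))

  coefficient-dilate : ∀ {n} D N (h : IntZ n) → degree (poly h) < N → ∀ js →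
                       coefficient js (dilate D h) ≡ ∑boxℤ N n (λ ks → coefficient ks h ℤ.* dilationEntry D js ks)
  coefficient-dilate {n} D N h deg<N js = begin
    coefficient js (dilate D h)
      ≡⟨ ΔAlong-cong (allFin n) js (≈ᶻ-∑boxᶻ N n (dilate D h) (λ ks → coefficient ks h) (dilate D ∘ basis)
                                       (λ x → basis-expansion N h deg<N (λ j → + D ℤ.* x j))) _ ⟩
    coefficient js (∑boxᶻ N n (λ ks → coefficient ks h ·ᶻ dilate D (basis ks)))
      ≡⟨ coefficient-∑boxᶻ js N n (λ ks → coefficient ks h) (dilate D ∘ basis) ⟩
    ∑boxℤ N n (λ ks → coefficient ks h ℤ.* coefficient js (dilate D (basis ks)))
      ≡⟨ ∑box-cong ℤ-monoid N n (λ ks _ → cong (coefficient ks h ℤ.*_) (coefficient-dilate-basis D js ks)) ⟩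
    ∑boxℤ N n (λ ks → coefficient ks h ℤ.* dilationEntry D js ks) ∎
    where open ≡-Reasoning

module Determinants where

  open import Data.Nat using (zero; suc)
  open import Data.Integer as ℤ using ()
  import Data.Integer.Properties as ℤP
  open import Data.Integer.Solver using (module +-*-Solver)
  open +-*-Solver using (solve; _:-_; _:*_; _:=_; :-_; con)
  open import Data.Fin as Fin using (Fin; zero; suc; punchIn; punchOut; toℕ)
  import Data.Fin.Properties as FinP
  open import Algebra.Properties.Semiring.Sum ℤP.+-*-semiring
    using (sum; sum-cong-≗; ∑-comm; sum-remove; *-distribˡ-sum; *-distribʳ-sum)
  open import Data.Product using (Σ; _×_; _,_; proj₁; proj₂)
  open import Function using (_∘_)
  open import Relation.Binary.PropositionalEquality
  open import Relation.Nullary using (yes; no)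
  open import Data.Empty using (⊥-elim)
  open NewtonExpansion using (ℤ-monoid)
  open BoxSums using (sum-single; sum-ε)

  sumℤ≡sum : ∀ {n} (f : Fin n → ℤ) → sumℤ f ≡ sum f
  sumℤ≡sum {zero}  f = refl
  sumℤ≡sum {suc n} f = cong (ℤ._+_ (f zero)) (sumℤ≡sum (f ∘ suc))

  altSign : ∀ {n} → Fin n → ℤ
  altSign i = sign (toℕ i)
    where
    sign : ℕ → ℤ
    sign zero    = + 1
    sign (suc k) = ℤ.- sign k

  altSum≡sum : ∀ {n} (f : Fin n → ℤ) → altSum f ≡ sum (λ j → altSign j ℤ.* f j)
  altSum≡sum {zero}  f = refl
  altSum≡sum {suc n} f = cong₂ ℤ._+_ (sym (ℤP.*-identityˡ (f zero)))
    (trans (cong ℤ.-_ (altSum≡sum (f ∘ suc)))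
    (trans (sym (ℤP.-1*i≡-i _))
    (trans (*-distribˡ-sum (ℤ.- + 1) (λ j → altSign j ℤ.* f (suc j)))
           (sum-cong-≗ (λ j → trans (ℤP.-1*i≡-i _) (ℤP.neg-distribˡ-* (altSign j) (f (suc j))))))))

  minor : ∀ {n} → Mat (suc n) → Fin (suc n) → Fin (suc n) → Mat n
  minor M r c i k = M (punchIn r i) (punchIn c k)

  det-expand-row₀ : ∀ {n} (M : Mat (suc n)) → det M ≡ sum (λ c → altSign c ℤ.* (M zero c ℤ.* det (minor M zero c)))
  det-expand-row₀ M = altSum≡sum (λ c → M zero c ℤ.* det (minor M zero c))

  det-cong : ∀ {n} {M N : Mat n} → (∀ i j → M i j ≡ N i j) → det M ≡ det N
  det-cong {zero}          M≡N = refl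
  det-cong {suc n} {M} {N} M≡N =
    trans (det-expand-row₀ M)
          (trans (sum-cong-≗ {suc n} (λ j → cong (altSign j ℤ.*_)
                   (cong₂ ℤ._*_ (M≡N zero j) (det-cong (λ i k → M≡N (suc i) (punchIn j k))))))
                 (sym (det-expand-row₀ N)))

  -- the position of column c in the minor that deletes column punchIn c b
  otherColumn : ∀ {m} → Fin (suc (suc m)) → Fin (suc m) → Fin (suc m)
  otherColumn zero    b                = zero
  otherColumn (suc c) zero             = c
  otherColumn {suc m} (suc c) (suc b)  = suc (otherColumn c b)

  punchIn-otherColumn : ∀ {m} (c : Fin (suc (suc m))) b → punchIn (punchIn c b) (otherColumn c b) ≡ c
  punchIn-otherColumn zero    b               = refl
  punchIn-otherColumn (suc c) zero            = refl
  punchIn-otherColumn {suc m} (suc c) (suc b) = cong suc (punchIn-otherColumn c b)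

  punchIn-punchIn-otherColumn : ∀ {m} (c : Fin (suc (suc m))) b (k : Fin m) →
                                punchIn (punchIn c b) (punchIn (otherColumn c b) k) ≡ punchIn c (punchIn b k)
  punchIn-punchIn-otherColumn zero    b               k       = refl
  punchIn-punchIn-otherColumn (suc c) zero            k       = refl
  punchIn-punchIn-otherColumn {suc m} (suc c) (suc b) zero    = refl
  punchIn-punchIn-otherColumn {suc m} (suc c) (suc b) (suc k) = cong suc (punchIn-punchIn-otherColumn c b k)

  altSign-otherColumn : ∀ {m} (c : Fin (suc (suc m))) b →
                        altSign (punchIn c b) ℤ.* altSign (otherColumn c b) ≡ ℤ.- (altSign b ℤ.* altSign c)
  altSign-otherColumn zero    b    = solve 1 (λ x → (:- x) :* con (+ 1) := :- (x :* con (+ 1))) refl (altSign b)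
  altSign-otherColumn (suc c) zero = solve 1 (λ x → con (+ 1) :* x := :- (con (+ 1) :* (:- x))) refl (altSign c)
  altSign-otherColumn {suc m} (suc c) (suc b) = begin
    ℤ.- altSign (punchIn c b) ℤ.* ℤ.- altSign (otherColumn c b)
      ≡⟨ solve 2 (λ x y → (:- x) :* (:- y) := x :* y) refl (altSign (punchIn c b)) (altSign (otherColumn c b)) ⟩
    altSign (punchIn c b) ℤ.* altSign (otherColumn c b)
      ≡⟨ altSign-otherColumn c b ⟩
    ℤ.- (altSign b ℤ.* altSign c)
      ≡⟨ solve 2 (λ x y → :- (x :* y) := :- ((:- x) :* (:- y))) refl (altSign b) (altSign c) ⟩
    ℤ.- (ℤ.- altSign b ℤ.* ℤ.- altSign c) ∎
    where open ≡-Reasoning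

  det-expand-column : ∀ {n} (M : Mat (suc n)) c →
                      det M ≡ sum (λ r → altSign r ℤ.* altSign c ℤ.* (M r c ℤ.* det (minor M r c)))

  -- the row-0 terms off column c, each expanded along column c of its minor
  det-expand-column-rest : ∀ {m} (M : Mat (suc m)) c →
    sum (λ b → altSign (punchIn c b) ℤ.* (M zero (punchIn c b) ℤ.* det (minor M zero (punchIn c b)))) ≡
    sum (λ s → altSign (suc s) ℤ.* altSign c ℤ.* (M (suc s) c ℤ.* det (minor M (suc s) c)))

  det-expand-column {n} M c = begin
    det M                                     ≡⟨ det-expand-row₀ M ⟩
    sum T                                     ≡⟨ sum-remove {i = c} T ⟩
    T c ℤ.+ sum (λ b → T (punchIn c b))       ≡⟨ cong₂ ℤ._+_ (solve 2 (λ s m → s :* m := con (+ 1) :* s :* m) refl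
                                                                (altSign c) (M zero c ℤ.* det (minor M zero c)))
                                                             (det-expand-column-rest M c) ⟩
    sum (λ r → altSign r ℤ.* altSign c ℤ.* (M r c ℤ.* det (minor M r c))) ∎
    where
    open ≡-Reasoning
    T : Fin (suc n) → ℤ
    T c′ = altSign c′ ℤ.* (M zero c′ ℤ.* det (minor M zero c′))

  det-expand-column-rest {zero}  M c = refl
  det-expand-column-rest {suc m} M c = begin
    sum (λ b → altSign (d b) ℤ.* (M zero (d b) ℤ.* det (minor M zero (d b))))
      ≡⟨ sum-cong-≗ {suc m} (λ b → expand-minor b) ⟩
    sum (λ b → sum (λ s → F b s))
      ≡⟨ ∑-comm F ⟩
    sum (λ s → sum (λ b → F b s))
      ≡⟨ sum-cong-≗ {suc m} (λ s → sym (collect-row s)) ⟩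
    sum (λ s → altSign (suc s) ℤ.* altSign c ℤ.* (M (suc s) c ℤ.* det (minor M (suc s) c))) ∎
    where
    open ≡-Reasoning
    d : Fin (suc m) → Fin (suc (suc m))
    d b = punchIn c b
    E : Fin (suc m) → Fin (suc m) → ℤ
    E s b = det (minor (minor M (suc s) c) zero b)
    F : Fin (suc m) → Fin (suc m) → ℤ
    F b s = ℤ.- (altSign b ℤ.* altSign c) ℤ.* altSign s ℤ.* (M zero (d b) ℤ.* (M (suc s) c ℤ.* E s b))
    expand-minor : ∀ b → altSign (d b) ℤ.* (M zero (d b) ℤ.* det (minor M zero (d b))) ≡ sum (λ s → F b s)
    expand-minor b = begin
      altSign (d b) ℤ.* (M zero (d b) ℤ.* det (minor M zero (d b)))
        ≡⟨ cong (λ z → altSign (d b) ℤ.* (M zero (d b) ℤ.* z)) (det-expand-column (minor M zero (d b)) o) ⟩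
      altSign (d b) ℤ.* (M zero (d b) ℤ.* sum (λ s → altSign s ℤ.* altSign o ℤ.*
                 (M (suc s) (punchIn (d b) o) ℤ.* det (minor (minor M zero (d b)) s o))))
        ≡⟨ cong (λ z → altSign (d b) ℤ.* (M zero (d b) ℤ.* z)) (sum-cong-≗ {suc m} (λ s →
             cong₂ (λ u v → altSign s ℤ.* altSign o ℤ.* (M (suc s) u ℤ.* v)) (punchIn-otherColumn c b)
                   (det-cong (λ i k → cong (M (suc (punchIn s i))) (punchIn-punchIn-otherColumn c b k))))) ⟩
      altSign (d b) ℤ.* (M zero (d b) ℤ.* sum (λ s → altSign s ℤ.* altSign o ℤ.* (M (suc s) c ℤ.* E s b)))
        ≡⟨ cong (altSign (d b) ℤ.*_) (*-distribˡ-sum (M zero (d b)) (λ s → altSign s ℤ.* altSign o ℤ.* (M (suc s) c ℤ.* E s b))) ⟩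
      altSign (d b) ℤ.* sum (λ s → M zero (d b) ℤ.* (altSign s ℤ.* altSign o ℤ.* (M (suc s) c ℤ.* E s b)))
        ≡⟨ *-distribˡ-sum (altSign (d b)) (λ s → M zero (d b) ℤ.* (altSign s ℤ.* altSign o ℤ.* (M (suc s) c ℤ.* E s b))) ⟩
      sum (λ s → altSign (d b) ℤ.* (M zero (d b) ℤ.* (altSign s ℤ.* altSign o ℤ.* (M (suc s) c ℤ.* E s b))))
        ≡⟨ sum-cong-≗ {suc m} (λ s → trans
             (solve 6 (λ x y z w u v → x :* (y :* (z :* w :* (u :* v))) := x :* w :* z :* (y :* (u :* v))) refl
                      (altSign (d b)) (M zero (d b)) (altSign s) (altSign o) (M (suc s) c) (E s b))
             (cong (λ z → z ℤ.* altSign s ℤ.* (M zero (d b) ℤ.* (M (suc s) c ℤ.* E s b))) (altSign-otherColumn c b))) ⟩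
      sum (λ s → F b s) ∎
      where o = otherColumn c b
    collect-row : ∀ s → altSign (suc s) ℤ.* altSign c ℤ.* (M (suc s) c ℤ.* det (minor M (suc s) c)) ≡ sum (λ b → F b s)
    collect-row s = begin
      altSign (suc s) ℤ.* altSign c ℤ.* (M (suc s) c ℤ.* det (minor M (suc s) c))
        ≡⟨ cong (λ z → altSign (suc s) ℤ.* altSign c ℤ.* (M (suc s) c ℤ.* z)) (det-expand-row₀ (minor M (suc s) c)) ⟩
      σ ℤ.* (M (suc s) c ℤ.* sum (λ b → altSign b ℤ.* (M zero (d b) ℤ.* E s b)))
        ≡⟨ cong (σ ℤ.*_) (*-distribˡ-sum (M (suc s) c) (λ b → altSign b ℤ.* (M zero (d b) ℤ.* E s b))) ⟩
      σ ℤ.* sum (λ b → M (suc s) c ℤ.* (altSign b ℤ.* (M zero (d b) ℤ.* E s b)))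
        ≡⟨ *-distribˡ-sum σ (λ b → M (suc s) c ℤ.* (altSign b ℤ.* (M zero (d b) ℤ.* E s b))) ⟩
      sum (λ b → σ ℤ.* (M (suc s) c ℤ.* (altSign b ℤ.* (M zero (d b) ℤ.* E s b))))
        ≡⟨ sum-cong-≗ {suc m} (λ b → solve 6 (λ x y z w u v → (:- x) :* y :* (z :* (w :* (u :* v))) := :- (w :* y) :* x :* (u :* (z :* v)))
                                      refl (altSign s) (altSign c) (M (suc s) c) (altSign b) (M zero (d b)) (E s b)) ⟩
      sum (λ b → F b s) ∎
      where σ = altSign (suc s) ℤ.* altSign c

  avoid : ∀ {m} (p q : Fin (suc (suc (suc m)))) → Σ (Fin (suc (suc (suc m)))) (λ c → c ≢ p × c ≢ q)
  avoid (suc p)       (suc q)       = zero , (λ ()) , (λ ())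
  avoid zero          zero          = suc zero , (λ ()) , (λ ())
  avoid zero          (suc zero)    = suc (suc zero) , (λ ()) , (λ ())
  avoid zero          (suc (suc q)) = suc zero , (λ ()) , (λ ())
  avoid (suc zero)    zero          = suc (suc zero) , (λ ()) , (λ ())
  avoid (suc (suc p)) zero          = suc zero , (λ ()) , (λ ())

  det-equal-columns : ∀ {n} (N : Mat n) p q → p ≢ q → (∀ r → N r p ≡ N r q) → det N ≡ + 0
  det-equal-columns {1} N zero zero p≢q _ = ⊥-elim (p≢q refl)
  det-equal-columns {2} N zero zero p≢q _ = ⊥-elim (p≢q refl)
  det-equal-columns {2} N (suc zero) (suc zero) p≢q _ = ⊥-elim (p≢q refl)
  det-equal-columns {2} N zero (suc zero) _ N₀≡N₁ =
    trans (cong₂ (λ u v → u ℤ.* (N (suc zero) (suc zero) ℤ.* + 1 ℤ.- + 0) ℤ.- (N zero (suc zero) ℤ.* (v ℤ.* + 1 ℤ.- + 0) ℤ.- + 0))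
                 (N₀≡N₁ zero) (N₀≡N₁ (suc zero)))
          (solve 2 (λ a b → a :* (b :* con (+ 1) :- con (+ 0)) :- (a :* (b :* con (+ 1) :- con (+ 0)) :- con (+ 0)) := con (+ 0))
                 refl (N zero (suc zero)) (N (suc zero) (suc zero)))
  det-equal-columns {2} N (suc zero) zero _ N₁≡N₀ =
    trans (cong₂ (λ u v → N zero zero ℤ.* (u ℤ.* + 1 ℤ.- + 0) ℤ.- (v ℤ.* (N (suc zero) zero ℤ.* + 1 ℤ.- + 0) ℤ.- + 0))
                 (N₁≡N₀ (suc zero)) (N₁≡N₀ zero))
          (solve 2 (λ a b → a :* (b :* con (+ 1) :- con (+ 0)) :- (a :* (b :* con (+ 1) :- con (+ 0)) :- con (+ 0)) := con (+ 0))
                 refl (N zero zero) (N (suc zero) zero))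
  det-equal-columns {suc (suc (suc m))} N p q p≢q Nₚ≡N_q =
    trans (det-expand-column N c)
          (trans (sum-cong-≗ {suc (suc (suc m))} (λ r → trans
                   (cong (λ z → altSign r ℤ.* altSign c ℤ.* (N r c ℤ.* z))
                         (det-equal-columns (minor N r c) (punchOut c≢p) (punchOut c≢q)
                            (p≢q ∘ FinP.punchOut-injective c≢p c≢q)
                            (λ i → trans (cong (N (punchIn r i)) (FinP.punchIn-punchOut c≢p))
                                   (trans (Nₚ≡N_q (punchIn r i)) (cong (N (punchIn r i)) (sym (FinP.punchIn-punchOut c≢q)))))))
                   (solve 3 (λ a b x → a :* b :* (x :* con (+ 0)) := con (+ 0)) refl (altSign r) (altSign c) (N r c))))
                 (sum-ε ℤ-monoid {suc (suc (suc m))} (λ _ → + 0) (λ _ → refl)))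
    where
    c = proj₁ (avoid p q)
    c≢p = proj₁ (proj₂ (avoid p q))
    c≢q = proj₂ (proj₂ (avoid p q))

  _ᵀ : ∀ {n} → Mat n → Mat n
  (M ᵀ) i j = M j i

  det-ᵀ : ∀ {n} (M : Mat n) → det (M ᵀ) ≡ det M
  det-ᵀ {zero}  M = refl
  det-ᵀ {suc n} M = begin
    det (M ᵀ)
      ≡⟨ det-expand-row₀ (M ᵀ) ⟩
    sum (λ c → altSign c ℤ.* (M c zero ℤ.* det (minor M c zero ᵀ)))
      ≡⟨ sum-cong-≗ {suc n} (λ c → cong (λ z → altSign c ℤ.* (M c zero ℤ.* z)) (det-ᵀ (minor M c zero))) ⟩
    sum (λ c → altSign c ℤ.* (M c zero ℤ.* det (minor M c zero)))
      ≡⟨ sum-cong-≗ {suc n} (λ c → cong (ℤ._* (M c zero ℤ.* det (minor M c zero))) (sym (ℤP.*-identityʳ (altSign c)))) ⟩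
    sum (λ r → altSign r ℤ.* altSign {suc n} zero ℤ.* (M r zero ℤ.* det (minor M r zero)))
      ≡⟨ sym (det-expand-column M zero) ⟩
    det M ∎
    where open ≡-Reasoning

  adjugate : ∀ {n} → Mat (suc n) → Mat (suc n)
  adjugate M i j = altSign j ℤ.* altSign i ℤ.* det (minor M j i)

  replaceColumn : ∀ {n} → Mat n → Fin n → Fin n → Mat n
  replaceColumn M i k r c with c Fin.≟ i
  ... | yes _ = M r k
  ... | no  _ = M r c

  replaceColumn-self : ∀ {n} (M : Mat n) i k r → replaceColumn M i k r i ≡ M r k
  replaceColumn-self M i k r with i Fin.≟ i
  ... | yes _   = refl
  ... | no  i≢i = ⊥-elim (i≢i refl)

  replaceColumn-other : ∀ {n} (M : Mat n) i k r c → c ≢ i → replaceColumn M i k r c ≡ M r c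
  replaceColumn-other M i k r c c≢i with c Fin.≟ i
  ... | yes c≡i = ⊥-elim (c≢i c≡i)
  ... | no  _   = refl

  adjugate-diagonal : ∀ {n} (M : Mat (suc n)) i → sum (λ j → adjugate M i j ℤ.* M j i) ≡ det M
  adjugate-diagonal {n} M i = sym (trans (det-expand-column M i) (sum-cong-≗ {suc n} (λ j →
    solve 4 (λ a b m d → a :* b :* (m :* d) := a :* b :* d :* m) refl (altSign j) (altSign i) (M j i) (det (minor M j i)))))

  -- off the diagonal one gets the column expansion of a matrix with two equal columns
  adjugate-off-diagonal : ∀ {n} (M : Mat (suc n)) i k → i ≢ k → sum (λ j → adjugate M i j ℤ.* M j k) ≡ + 0
  adjugate-off-diagonal {n} M i k i≢k = begin
    sum (λ j → adjugate M i j ℤ.* M j k)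
      ≡⟨ sum-cong-≗ {suc n} (λ j → trans (solve 4 (λ a b d m → a :* b :* d :* m := a :* b :* (m :* d)) refl
                                          (altSign j) (altSign i) (det (minor M j i)) (M j k))
           (cong₂ (λ u v → altSign j ℤ.* altSign i ℤ.* (u ℤ.* v)) (sym (replaceColumn-self M i k j))
             (det-cong (λ a b → sym (replaceColumn-other M i k (punchIn j a) (punchIn i b) (FinP.punchInᵢ≢i i b)))))) ⟩
    sum (λ j → altSign j ℤ.* altSign i ℤ.* (N j i ℤ.* det (minor N j i)))
      ≡⟨ sym (det-expand-column N i) ⟩
    det N
      ≡⟨ det-equal-columns N i k i≢k (λ r → trans (replaceColumn-self M i k r)
                                                  (sym (replaceColumn-other M i k r k (i≢k ∘ sym)))) ⟩
    + 0 ∎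
    where
    open ≡-Reasoning
    N = replaceColumn M i k

  apply-apply : ∀ {n} (A B : Mat n) x i → apply A (apply B x) i ≡ sum (λ k → sum (λ j → A i j ℤ.* B j k) ℤ.* x k)
  apply-apply {n} A B x i = begin
    sumℤ (λ j → A i j ℤ.* sumℤ (λ k → B j k ℤ.* x k))
      ≡⟨ trans (sumℤ≡sum (λ j → A i j ℤ.* sumℤ (λ k → B j k ℤ.* x k)))
               (sum-cong-≗ {n} (λ j → cong (A i j ℤ.*_) (sumℤ≡sum (λ k → B j k ℤ.* x k)))) ⟩
    sum (λ (j : Fin n) → A i j ℤ.* sum (λ (k : Fin n) → B j k ℤ.* x k))
      ≡⟨ sum-cong-≗ {n} (λ j → trans (*-distribˡ-sum (A i j) (λ k → B j k ℤ.* x k))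
                                 (sum-cong-≗ {n} (λ k → sym (ℤP.*-assoc (A i j) (B j k) (x k))))) ⟩
    sum (λ j → sum (λ k → A i j ℤ.* B j k ℤ.* x k))
      ≡⟨ ∑-comm (λ j k → A i j ℤ.* B j k ℤ.* x k) ⟩
    sum (λ k → sum (λ j → A i j ℤ.* B j k ℤ.* x k))
      ≡⟨ sum-cong-≗ {n} (λ k → sym (*-distribʳ-sum (x k) (λ j → A i j ℤ.* B j k))) ⟩
    sum (λ k → sum (λ j → A i j ℤ.* B j k) ℤ.* x k) ∎
    where open ≡-Reasoning

  apply-adjugate : ∀ {n} (M : Mat (suc n)) x i → apply (adjugate M) (apply M x) i ≡ det M ℤ.* x i
  apply-adjugate M x i =
    trans (apply-apply (adjugate M) M x i)
          (trans (sum-single ℤ-monoid _ i (λ k k≢i →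
                    trans (cong (ℤ._* x k) (adjugate-off-diagonal M i k (k≢i ∘ sym))) (ℤP.*-zeroˡ (x k))))
                 (cong (ℤ._* x i) (adjugate-diagonal M i)))

  adjugateᵀ : ∀ {n} → Mat (suc n) → Mat (suc n)
  adjugateᵀ M i j = adjugate (M ᵀ) j i

  apply-adjugateᵀ : ∀ {n} (M : Mat (suc n)) x i → apply M (apply (adjugateᵀ M) x) i ≡ det M ℤ.* x i
  apply-adjugateᵀ {n} M x i =
    trans (apply-apply M (adjugateᵀ M) x i)
          (trans (sum-cong-≗ {suc n} (λ k → cong (ℤ._* x k) (sum-cong-≗ {suc n} (λ j → ℤP.*-comm (M i j) (adjugate (M ᵀ) k j)))))
          (trans (sum-single ℤ-monoid _ i (λ k k≢i →
                    trans (cong (ℤ._* x k) (adjugate-off-diagonal (M ᵀ) k i k≢i)) (ℤP.*-zeroˡ (x k))))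
                 (cong (ℤ._* x i) (trans (adjugate-diagonal (M ᵀ) i) (det-ᵀ M)))))

module CanonicalHomomorphism {c ℓ} (R : CommutativeRing c ℓ) where

  open import Data.Nat as ℕ using (zero; suc)
  open import Data.Integer as ℤ using (-[1+_])
  import Data.Integer.Properties as ℤP
  open import Algebra.Bundles using (AbelianGroup)
  import Relation.Binary.PropositionalEquality as ≡
  open CommutativeRing R
  open import Algebra.Properties.Group (AbelianGroup.group +-abelianGroup)
    using (⁻¹-anti-homo-∙) renaming (∙-cancelʳ to +-cancelʳ)
  open import Relation.Binary.Reasoning.Setoid setoid
  open Tensor R using (natR; fromℤ)
  open Integers using (succ; ℤ-induction)

  natR-+ : ∀ m k → natR (m ℕ.+ k) ≈ natR m + natR k
  natR-+ zero    k = sym (+-identityˡ _)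
  natR-+ (suc m) k = trans (+-cong refl (natR-+ m k)) (sym (+-assoc _ _ _))

  fromℤ-1 : fromℤ (+ 1) ≈ 1#
  fromℤ-1 = +-identityʳ 1#

  fromℤ-succ : ∀ z → fromℤ (succ z) ≈ fromℤ z + 1#
  fromℤ-succ (+ m)            = trans (natR-+ m 1) (+-cong refl fromℤ-1)
  fromℤ-succ -[1+ zero ]      = begin
    0#                   ≈⟨ sym (-‿inverseˡ 1#) ⟩
    - 1# + 1#            ≈⟨ +-cong (-‿cong (sym (+-identityʳ 1#))) refl ⟩
    - (1# + 0#) + 1#     ∎
  fromℤ-succ -[1+ suc m ]     = sym (begin
    - (1# + (1# + natR m)) + 1#          ≈⟨ +-cong (⁻¹-anti-homo-∙ 1# (1# + natR m)) refl ⟩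
    - (1# + natR m) + - 1# + 1#          ≈⟨ +-assoc _ _ _ ⟩
    - (1# + natR m) + (- 1# + 1#)        ≈⟨ +-cong refl (-‿inverseˡ 1#) ⟩
    - (1# + natR m) + 0#                 ≈⟨ +-identityʳ _ ⟩
    - (1# + natR m)                      ∎)

  fromℤ-+ : ∀ a b → fromℤ (a ℤ.+ b) ≈ fromℤ a + fromℤ b
  fromℤ-+ a b = ℤ-induction (λ b → ∀ a → fromℤ (a ℤ.+ b) ≈ fromℤ a + fromℤ b) base up down b a
    where
    base : ∀ a → fromℤ (a ℤ.+ + 0) ≈ fromℤ a + 0#
    base a = trans (reflexive (≡.cong fromℤ (ℤP.+-identityʳ a))) (sym (+-identityʳ _))
    shift : ∀ t a → fromℤ (a ℤ.+ succ t) ≈ fromℤ (a ℤ.+ t) + 1#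
    shift t a = trans (reflexive (≡.cong fromℤ (≡.sym (ℤP.+-assoc a t (+ 1))))) (fromℤ-succ (a ℤ.+ t))
    up : ∀ t → (∀ a → fromℤ (a ℤ.+ t) ≈ fromℤ a + fromℤ t) → ∀ a → fromℤ (a ℤ.+ succ t) ≈ fromℤ a + fromℤ (succ t)
    up t hyp a = begin
      fromℤ (a ℤ.+ succ t)        ≈⟨ shift t a ⟩
      fromℤ (a ℤ.+ t) + 1#        ≈⟨ +-cong (hyp a) refl ⟩
      fromℤ a + fromℤ t + 1#      ≈⟨ +-assoc _ _ _ ⟩
      fromℤ a + (fromℤ t + 1#)    ≈⟨ +-cong refl (sym (fromℤ-succ t)) ⟩
      fromℤ a + fromℤ (succ t)    ∎
    down : ∀ t → (∀ a → fromℤ (a ℤ.+ succ t) ≈ fromℤ a + fromℤ (succ t)) → ∀ a → fromℤ (a ℤ.+ t) ≈ fromℤ a + fromℤ t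
    down t hyp a = +-cancelʳ 1# _ _ (begin
      fromℤ (a ℤ.+ t) + 1#        ≈⟨ shift t a ⟨
      fromℤ (a ℤ.+ succ t)        ≈⟨ hyp a ⟩
      fromℤ a + fromℤ (succ t)    ≈⟨ +-cong refl (fromℤ-succ t) ⟩
      fromℤ a + (fromℤ t + 1#)    ≈⟨ +-assoc _ _ _ ⟨
      fromℤ a + fromℤ t + 1#      ∎)

  fromℤ-* : ∀ a b → fromℤ (a ℤ.* b) ≈ fromℤ a * fromℤ b
  fromℤ-* a = ℤ-induction (λ b → fromℤ (a ℤ.* b) ≈ fromℤ a * fromℤ b) base up down
    where
    base : fromℤ (a ℤ.* + 0) ≈ fromℤ a * 0#
    base = trans (reflexive (≡.cong fromℤ (ℤP.*-zeroʳ a))) (sym (zeroʳ _))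
    lhs : ∀ t → fromℤ (a ℤ.* succ t) ≈ fromℤ (a ℤ.* t) + fromℤ a
    lhs t = trans (reflexive (≡.cong fromℤ (≡.trans (ℤP.*-distribˡ-+ a t (+ 1)) (≡.cong (ℤ._+_ (a ℤ.* t)) (ℤP.*-identityʳ a)))))
                  (fromℤ-+ (a ℤ.* t) a)
    rhs : ∀ t → fromℤ a * fromℤ (succ t) ≈ fromℤ a * fromℤ t + fromℤ a
    rhs t = trans (*-cong refl (fromℤ-succ t)) (trans (distribˡ _ _ _) (+-cong refl (*-identityʳ _)))
    up : ∀ t → fromℤ (a ℤ.* t) ≈ fromℤ a * fromℤ t → fromℤ (a ℤ.* succ t) ≈ fromℤ a * fromℤ (succ t)
    up t hyp = trans (lhs t) (trans (+-cong hyp refl) (sym (rhs t)))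
    down : ∀ t → fromℤ (a ℤ.* succ t) ≈ fromℤ a * fromℤ (succ t) → fromℤ (a ℤ.* t) ≈ fromℤ a * fromℤ t
    down t hyp = +-cancelʳ (fromℤ a) _ _ (trans (sym (lhs t)) (trans hyp (rhs t)))

module TensorProduct {c ℓ} (R : CommutativeRing c ℓ) where

  open import Level using (_⊔_)
  open import Data.Integer as ℤ using ()
  import Data.Integer.Properties as ℤP
  open import Data.List using ([]; _∷_; _++_; map)
  import Data.List.Properties as ListP
  open import Data.Vec using (Vec; allFin)
  open import Data.Product using (_,_; proj₁; proj₂)
  open import Algebra.Bundles using (CommutativeMonoid; Monoid)
  open import Relation.Binary.Bundles using (Setoid)
  import Relation.Binary.Reasoning.Setoid as SetoidReasoning
  open import Relation.Binary.PropositionalEquality as ≡ using (_≡_)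
  open CommutativeRing R
  open import Algebra.Properties.Ring ring using (-1*x≈-x)
  open Tensor R
  open CanonicalHomomorphism R
  open Integers using (succ; ℤ-induction)
  open IntegerValued
  open NewtonExpansion using (∑boxℤ; ∑boxᶻ; IntZ-monoid; ≈ᶻ-∑boxᶻ; coefficient; ΔAlong-cong; ΔAlong-+)
  open BoxSums

  module _ {n : ℕ} where

    ∼-setoid : Setoid c (c ⊔ ℓ)
    ∼-setoid = record { Carrier = IntR n ; _≈_ = _∼_
                      ; isEquivalence = record { refl = ∼-refl ; sym = ∼-sym ; trans = ∼-trans } }

    ∼-≡ : ∀ {f g : IntR n} → f ≡ g → f ∼ g
    ∼-≡ ≡.refl = ∼-refl

    IntR-commutativeMonoid : CommutativeMonoid c (c ⊔ ℓ)
    IntR-commutativeMonoid = record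
      { Carrier = IntR n ; _≈_ = _∼_ ; _∙_ = _++_ ; ε = []
      ; isCommutativeMonoid = record
        { isMonoid = record
          { isSemigroup = record
            { isMagma = record { isEquivalence = Setoid.isEquivalence ∼-setoid ; ∙-cong = ∼-++ }
            ; assoc = λ f g h → ∼-≡ (ListP.++-assoc f g h) }
          ; identity = (λ _ → ∼-refl) , (λ f → ∼-≡ (ListP.++-identityʳ f)) }
        ; comm = ∼-comm } }

    IntR-monoid : Monoid c (c ⊔ ℓ)
    IntR-monoid = CommutativeMonoid.monoid IntR-commutativeMonoid

    ∑box⊗ : ℕ → (m : ℕ) → (Vec ℕ m → IntR n) → IntR n
    ∑box⊗ = ∑box IntR-monoid

    infix 8 _⊗_

    _⊗_ : IntZ n → Carrier → IntR n
    h ⊗ a = (h , a) ∷ []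

    ++-scale-neg : ∀ (f : IntR n) → f ++ scale (- 1#) f ∼ []
    ++-scale-neg []            = ∼-refl
    ++-scale-neg ((h , a) ∷ f) = begin
      h ⊗ a ++ (f ++ h ⊗ b ++ scale (- 1#) f)   ≈⟨ ∼-++ (∼-refl {f = h ⊗ a}) (∼-trans (∼-≡ (≡.sym (ListP.++-assoc f (h ⊗ b) (scale (- 1#) f))))
                                                    (∼-trans (∼-++ (∼-comm f (h ⊗ b)) ∼-refl) (∼-≡ (ListP.++-assoc (h ⊗ b) f (scale (- 1#) f))))) ⟩
      h ⊗ a ++ (h ⊗ b ++ (f ++ scale (- 1#) f)) ≈⟨ ∼-++ {f = h ⊗ a ++ h ⊗ b} {f′ = []} pair (++-scale-neg f) ⟩
      []                                                  ∎
      where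
      open SetoidReasoning ∼-setoid
      b = - 1# * a
      pair : h ⊗ a ++ h ⊗ b ∼ []
      pair = ∼-trans (∼-sym (∼-addʳ h a (- 1# * a)))
               (∼-trans (∼-congʳ h _ _ (trans (+-cong refl (-1*x≈-x a)) (-‿inverseʳ a))) (∼-zero h))

    ∼-cancelˡ : ∀ (f : IntR n) {g g′} → f ++ g ∼ f ++ g′ → g ∼ g′
    ∼-cancelˡ f {g} {g′} eq = begin
      g                              ≈⟨ ∼-++ {f = []} {f′ = f′ ++ f} (∼-sym f′++f∼[]) ∼-refl ⟩
      (f′ ++ f) ++ g                 ≈⟨ ∼-≡ (ListP.++-assoc f′ f g) ⟩
      f′ ++ (f ++ g)                 ≈⟨ ∼-++ (∼-refl {f = f′}) eq ⟩
      f′ ++ (f ++ g′)                ≈⟨ ∼-≡ (≡.sym (ListP.++-assoc f′ f g′)) ⟩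
      (f′ ++ f) ++ g′                ≈⟨ ∼-++ f′++f∼[] ∼-refl ⟩
      g′                             ∎
      where
      open SetoidReasoning ∼-setoid
      f′ = scale (- 1#) f
      f′++f∼[] : f′ ++ f ∼ []
      f′++f∼[] = ∼-trans (∼-comm f′ f) (++-scale-neg f)

    ⊗-zero : ∀ (h : IntZ n) a → h ≈ᶻ 0ᶻ → h ⊗ a ∼ []
    ⊗-zero h a h≈0 = ∼-sym (∼-cancelˡ (h ⊗ a) (∼-trans (∼-≡ (ListP.++-identityʳ (h ⊗ a)))
                       (∼-addˡ h h h a (λ x → ≡.trans (h≈0 x) (≡.sym (≡.cong₂ ℤ._+_ (h≈0 x) (h≈0 x)))))))

    ⊗-succ : ∀ (G : IntZ n) z a → G ⊗ (fromℤ (succ z) * a) ∼ G ⊗ a ++ G ⊗ (fromℤ z * a)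
    ⊗-succ G z a = ∼-trans (∼-congʳ G _ _ (trans (*-cong (trans (fromℤ-succ z) (+-comm _ _)) refl)
                                              (trans (distribʳ a 1# (fromℤ z)) (+-cong (*-identityˡ a) refl))))
                           (∼-addʳ G a (fromℤ z * a))

    succ-* : ∀ z y → succ z ℤ.* y ≡ y ℤ.+ z ℤ.* y
    succ-* z y = ≡.trans (ℤP.*-distribʳ-+ y z (+ 1))
                         (≡.trans (ℤP.+-comm (z ℤ.* y) (+ 1 ℤ.* y)) (≡.cong (ℤ._+ z ℤ.* y) (ℤP.*-identityˡ y)))

    ⊗-scale : ∀ (G : IntZ n) z → ∀ H a → (∀ x → fun H x ≡ z ℤ.* fun G x) → H ⊗ a ∼ G ⊗ (fromℤ z * a)
    ⊗-scale G = ℤ-induction (λ z → ∀ H a → (∀ x → fun H x ≡ z ℤ.* fun G x) → H ⊗ a ∼ G ⊗ (fromℤ z * a)) base up down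
      where
      base : ∀ H a → (∀ x → fun H x ≡ + 0 ℤ.* fun G x) → H ⊗ a ∼ G ⊗ (0# * a)
      base H a H≡0 = ∼-trans (⊗-zero H a (λ x → ≡.trans (H≡0 x) (ℤP.*-zeroˡ (fun G x))))
                             (∼-sym (∼-trans (∼-congʳ G _ _ (zeroˡ a)) (∼-zero G)))
      up : ∀ z → (∀ H a → (∀ x → fun H x ≡ z ℤ.* fun G x) → H ⊗ a ∼ G ⊗ (fromℤ z * a)) →
           ∀ H a → (∀ x → fun H x ≡ succ z ℤ.* fun G x) → H ⊗ a ∼ G ⊗ (fromℤ (succ z) * a)
      up z hyp H a H≡ = ∼-trans (∼-addˡ G (z ·ᶻ G) H a (λ x → ≡.trans (H≡ x) (succ-* z (fun G x))))
                          (∼-trans (∼-++ (∼-refl {f = G ⊗ a}) (hyp (z ·ᶻ G) a (λ _ → ≡.refl))) (∼-sym (⊗-succ G z a)))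
      down : ∀ z → (∀ H a → (∀ x → fun H x ≡ succ z ℤ.* fun G x) → H ⊗ a ∼ G ⊗ (fromℤ (succ z) * a)) →
             ∀ H a → (∀ x → fun H x ≡ z ℤ.* fun G x) → H ⊗ a ∼ G ⊗ (fromℤ z * a)
      down z hyp H a H≡ = ∼-cancelˡ (G ⊗ a)
        (∼-trans (∼-sym (∼-addˡ G H (G +ᶻ H) a (λ _ → ≡.refl)))
          (∼-trans (hyp (G +ᶻ H) a (λ x → ≡.trans (≡.cong (ℤ._+_ (fun G x)) (H≡ x)) (≡.sym (succ-* z (fun G x)))))
                   (⊗-succ G z a)))

    ⊗-∑box : ∀ N m (h : IntZ n) a (c : Vec ℕ m → ℤ) (G : Vec ℕ m → IntZ n) →
             (∀ x → fun h x ≡ ∑boxℤ N m (λ ks → c ks ℤ.* fun (G ks) x)) →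
             h ⊗ a ∼ ∑box⊗ N m (λ ks → G ks ⊗ (fromℤ (c ks) * a))
    ⊗-∑box N m h a c G h≡ = begin
      h ⊗ a                                          ≈⟨ ∼-congˡ h _ a (≈ᶻ-∑boxᶻ N m h c G h≡) ⟩
      ∑boxᶻ N m (λ ks → c ks ·ᶻ G ks) ⊗ a            ≈⟨ ∑box-homo (IntZ-monoid n) IntR-monoid (_⊗ a) (λ g≈h → ∼-congˡ _ _ a g≈h)
                                                          (⊗-zero 0ᶻ a (λ _ → ≡.refl)) (λ g h → ∼-addˡ g h (g +ᶻ h) a (λ _ → ≡.refl)) N m _ ⟩
      ∑box⊗ N m (λ ks → (c ks ·ᶻ G ks) ⊗ a)          ≈⟨ ∑box-cong IntR-monoid N m (λ ks _ →
                                                          ⊗-scale (G ks) (c ks) (c ks ·ᶻ G ks) a (λ _ → ≡.refl)) ⟩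
      ∑box⊗ N m (λ ks → G ks ⊗ (fromℤ (c ks) * a))   ∎
      where open SetoidReasoning ∼-setoid

    mapZ : (IntZ n → IntZ n) → IntR n → IntR n
    mapZ ρ = map (λ p → ρ (proj₁ p) , proj₂ p)

    mapZ-∼ : ∀ (T : Pt n → Pt n) (ρ : IntZ n → IntZ n) → (∀ h x → fun (ρ h) x ≡ fun h (T x)) →
             ∀ {f g} → f ∼ g → mapZ ρ f ∼ mapZ ρ g
    mapZ-∼ T ρ ρ≡ ∼-refl                   = ∼-refl
    mapZ-∼ T ρ ρ≡ (∼-sym f∼g)              = ∼-sym (mapZ-∼ T ρ ρ≡ f∼g)
    mapZ-∼ T ρ ρ≡ (∼-trans f∼g g∼h)        = ∼-trans (mapZ-∼ T ρ ρ≡ f∼g) (mapZ-∼ T ρ ρ≡ g∼h)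
    mapZ-∼ T ρ ρ≡ (∼-++ {f} {f′} {g} {g′} f∼f′ g∼g′) =
      ∼-trans (∼-≡ (ListP.map-++ _ f g))
              (∼-trans (∼-++ (mapZ-∼ T ρ ρ≡ f∼f′) (mapZ-∼ T ρ ρ≡ g∼g′)) (∼-≡ (≡.sym (ListP.map-++ _ f′ g′))))
    mapZ-∼ T ρ ρ≡ (∼-comm f g)             =
      ∼-trans (∼-≡ (ListP.map-++ _ f g)) (∼-trans (∼-comm (mapZ ρ f) (mapZ ρ g)) (∼-≡ (≡.sym (ListP.map-++ _ g f))))
    mapZ-∼ T ρ ρ≡ (∼-congˡ h h′ a h≈h′)    =
      ∼-congˡ (ρ h) (ρ h′) a (λ x → ≡.trans (ρ≡ h x) (≡.trans (h≈h′ (T x)) (≡.sym (ρ≡ h′ x))))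
    mapZ-∼ T ρ ρ≡ (∼-congʳ h a b a≈b)      = ∼-congʳ (ρ h) a b a≈b
    mapZ-∼ T ρ ρ≡ (∼-addˡ h h′ h″ a h″≡)   =
      ∼-addˡ (ρ h) (ρ h′) (ρ h″) a (λ x → ≡.trans (ρ≡ h″ x) (≡.trans (h″≡ (T x)) (≡.sym (≡.cong₂ ℤ._+_ (ρ≡ h x) (ρ≡ h′ x)))))
    mapZ-∼ T ρ ρ≡ (∼-addʳ h a b)           = ∼-addʳ (ρ h) a b
    mapZ-∼ T ρ ρ≡ (∼-zero h)               = ∼-zero (ρ h)

    mapZ-cong : ∀ (ρ σ : IntZ n → IntZ n) → (∀ h → ρ h ≈ᶻ σ h) → ∀ f → mapZ ρ f ∼ mapZ σ f
    mapZ-cong ρ σ ρ≈σ []            = ∼-refl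
    mapZ-cong ρ σ ρ≈σ ((h , a) ∷ f) = ∼-++ (∼-congˡ (ρ h) (σ h) a (ρ≈σ h)) (mapZ-cong ρ σ ρ≈σ f)

    scale-∼ : ∀ r {f g : IntR n} → f ∼ g → scale r f ∼ scale r g
    scale-∼ r ∼-refl                  = ∼-refl
    scale-∼ r (∼-sym f∼g)             = ∼-sym (scale-∼ r f∼g)
    scale-∼ r (∼-trans f∼g g∼h)       = ∼-trans (scale-∼ r f∼g) (scale-∼ r g∼h)
    scale-∼ r (∼-++ {f} {f′} {g} {g′} f∼f′ g∼g′) =
      ∼-trans (∼-≡ (ListP.map-++ _ f g))
              (∼-trans (∼-++ (scale-∼ r f∼f′) (scale-∼ r g∼g′)) (∼-≡ (≡.sym (ListP.map-++ _ f′ g′))))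
    scale-∼ r (∼-comm f g)            =
      ∼-trans (∼-≡ (ListP.map-++ _ f g)) (∼-trans (∼-comm (scale r f) (scale r g)) (∼-≡ (≡.sym (ListP.map-++ _ g f))))
    scale-∼ r (∼-congˡ h h′ a h≈h′)   = ∼-congˡ h h′ (r * a) h≈h′
    scale-∼ r (∼-congʳ h a b a≈b)     = ∼-congʳ h (r * a) (r * b) (*-cong refl a≈b)
    scale-∼ r (∼-addˡ h h′ h″ a h″≡)  = ∼-addˡ h h′ h″ (r * a) h″≡
    scale-∼ r (∼-addʳ h a b)          = ∼-trans (∼-congʳ h _ _ (distribˡ r a b)) (∼-addʳ h (r * a) (r * b))
    scale-∼ r (∼-zero h)              = ∼-trans (∼-congʳ h _ _ (zeroʳ r)) (∼-zero h)

    scale-mapZ : ∀ r (ρ : IntZ n → IntZ n) f → scale r (mapZ ρ f) ≡ mapZ ρ (scale r f)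
    scale-mapZ r ρ []            = ≡.refl
    scale-mapZ r ρ ((h , a) ∷ f) = ≡.cong (_ ∷_) (scale-mapZ r ρ f)

    coeff : Vec ℕ n → IntR n → Carrier
    coeff js []            = 0#
    coeff js ((h , a) ∷ f) = fromℤ (coefficient js h) * a + coeff js f

    coeff-++ : ∀ js (f g : IntR n) → coeff js (f ++ g) ≈ coeff js f + coeff js g
    coeff-++ js []            g = sym (+-identityˡ _)
    coeff-++ js ((h , a) ∷ f) g = trans (+-cong refl (coeff-++ js f g)) (sym (+-assoc _ _ _))

    coeff-∼ : ∀ js {f g : IntR n} → f ∼ g → coeff js f ≈ coeff js g
    coeff-∼ js ∼-refl                  = refl
    coeff-∼ js (∼-sym f∼g)             = sym (coeff-∼ js f∼g)
    coeff-∼ js (∼-trans f∼g g∼h)       = trans (coeff-∼ js f∼g) (coeff-∼ js g∼h)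
    coeff-∼ js (∼-++ {f} {f′} {g} {g′} f∼f′ g∼g′) =
      trans (coeff-++ js f g) (trans (+-cong (coeff-∼ js f∼f′) (coeff-∼ js g∼g′)) (sym (coeff-++ js f′ g′)))
    coeff-∼ js (∼-comm f g)            = trans (coeff-++ js f g) (trans (+-comm _ _) (sym (coeff-++ js g f)))
    coeff-∼ js (∼-congˡ h h′ a h≈h′)   =
      +-cong (*-cong (reflexive (≡.cong fromℤ (ΔAlong-cong (allFin n) js h≈h′ (λ _ → + 0)))) refl) refl
    coeff-∼ js (∼-congʳ h a b a≈b)     = +-cong (*-cong refl a≈b) refl
    coeff-∼ js (∼-addˡ h h′ h″ a h″≡)  = begin
      fromℤ (coefficient js h″) * a + 0#
        ≈⟨ +-identityʳ _ ⟩
      fromℤ (coefficient js h″) * a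
        ≈⟨ *-cong (trans (reflexive (≡.cong fromℤ (≡.trans (ΔAlong-cong (allFin n) js h″≡ (λ _ → + 0))
                                                           (ΔAlong-+ (allFin n) js h h′ (λ _ → + 0)))))
                         (fromℤ-+ (coefficient js h) (coefficient js h′))) refl ⟩
      (fromℤ (coefficient js h) + fromℤ (coefficient js h′)) * a
        ≈⟨ distribʳ a _ _ ⟩
      fromℤ (coefficient js h) * a + fromℤ (coefficient js h′) * a
        ≈⟨ +-cong refl (sym (+-identityʳ _)) ⟩
      fromℤ (coefficient js h) * a + (fromℤ (coefficient js h′) * a + 0#) ∎
      where open SetoidReasoning setoid
    coeff-∼ js (∼-addʳ h a b)          = trans (+-cong (distribˡ _ a b) refl) (+-assoc _ _ _)
    coeff-∼ js (∼-zero h)              = trans (+-identityʳ _) (zeroʳ _)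

module MultiIndices where

  open import Data.Nat as ℕ using (_≤_; _<_; z≤n)
  import Data.Nat.Properties as ℕP
  open import Data.Vec as Vec using (Vec; []; _∷_)
  open import Data.Vec.Relation.Unary.All as All using (All; []; _∷_)
  open import Data.Vec.Relation.Binary.Pointwise.Inductive using (Pointwise; []; _∷_)
  open import Relation.Binary.PropositionalEquality
  open import Relation.Nullary using (yes; no)
  open import Function using (_∘_)
  open import Data.Empty using (⊥-elim)

  sum-≤ : ∀ {m} {js ks : Vec ℕ m} → Pointwise _≤_ js ks → Vec.sum js ≤ Vec.sum ks
  sum-≤ []             = z≤n
  sum-≤ (j≤k ∷ js≤ks) = ℕP.+-mono-≤ j≤k (sum-≤ js≤ks)

  sum-< : ∀ {m} {js ks : Vec ℕ m} → Pointwise _≤_ js ks → js ≢ ks → Vec.sum js < Vec.sum ks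
  sum-< {js = []}     {[]}     []             js≢ks = ⊥-elim (js≢ks refl)
  sum-< {js = j ∷ js} {k ∷ ks} (j≤k ∷ js≤ks) js≢ks with j ℕ.≟ k
  ... | yes refl = ℕP.+-monoʳ-< j (sum-< js≤ks (js≢ks ∘ cong (j ∷_)))
  ... | no  j≢k  = ℕP.+-mono-<-≤ (ℕP.≤∧≢⇒< j≤k j≢k) (sum-≤ js≤ks)

  sum-bounded : ∀ {m N} {ks : Vec ℕ m} → All (_< N) ks → Vec.sum ks ≤ m ℕ.* N
  sum-bounded []             = z≤n
  sum-bounded (k<N ∷ ks<N) = ℕP.+-mono-≤ (ℕP.<⇒≤ k<N) (sum-bounded ks<N)

  entries-≤-sum : ∀ {m} (ks : Vec ℕ m) → All (_≤ Vec.sum ks) ks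
  entries-≤-sum []       = []
  entries-≤-sum (k ∷ ks) = ℕP.m≤m+n k (Vec.sum ks)
                         ∷ All.map (λ k′≤ → ℕP.≤-trans k′≤ (ℕP.m≤n+m (Vec.sum ks) k)) (entries-≤-sum ks)

module Dilation {c ℓ} (R : CommutativeRing c ℓ) {n : ℕ} (D : ℕ)
                (D-unit : Tensor.IsUnit R (Tensor.fromℤ R (+ D))) where

  open import Level using (_⊔_)
  open import Data.Nat as ℕ using (zero; suc; _<_; _∸_; s≤s)
  import Data.Nat.Properties as ℕP
  open import Data.Nat.Induction using (<-rec)
  open import Data.Integer as ℤ using ()
  open import Data.List using ([]; _∷_; _++_)
  import Data.List.Properties as ListP
  open import Data.List.Relation.Unary.All as ListAll using ([]; _∷_)
  open import Data.Vec as Vec using (Vec)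
  import Data.Vec.Properties as VecP
  open import Data.Vec.Relation.Unary.All as All using (All)
  open import Data.Vec.Relation.Binary.Pointwise.Inductive as Pointwise using ()
  open import Data.Product using (Σ; _,_; proj₁; proj₂)
  open import Algebra.Bundles using (CommutativeMonoid; Monoid)
  open import Function using (_∘_)
  import Relation.Binary.Reasoning.Setoid as SetoidReasoning
  open import Relation.Binary.PropositionalEquality as ≡ using (_≡_; _≢_)
  open import Relation.Nullary using (Dec; yes; no)
  open CommutativeRing R
  open Tensor R
  open CanonicalHomomorphism R
  open TensorProduct R
  open IntegerValued using (degree; dilate)
  open NewtonExpansion using (ℤ-monoid; ∑boxℤ; basis; coefficient; basis-expansion)
  open DilatedBasis using (dilationEntry; coefficient-dilate; coefficient-dilate-basis; dilationEntry-high; dilationEntry-diagonal)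
  open MultiIndices
  open BoxSums

  private
    u = proj₁ D-unit
    D*u≈1 = proj₂ D-unit

  R-monoid : Monoid c ℓ
  R-monoid = CommutativeMonoid.monoid +-commutativeMonoid

  ∑boxᴿ : ℕ → (m : ℕ) → (Vec ℕ m → Carrier) → Carrier
  ∑boxᴿ = ∑box R-monoid

  fromℤ-∑boxℤ : ∀ N m f → fromℤ (∑boxℤ N m f) ≈ ∑boxᴿ N m (fromℤ ∘ f)
  fromℤ-∑boxℤ = ∑box-homo ℤ-monoid R-monoid fromℤ (reflexive ∘ ≡.cong fromℤ) refl fromℤ-+

  *-distribʳ-∑boxᴿ : ∀ a N m f → ∑boxᴿ N m f * a ≈ ∑boxᴿ N m (λ ks → f ks * a)
  *-distribʳ-∑boxᴿ a = ∑box-homo R-monoid R-monoid (_* a) (λ x≈y → *-cong x≈y refl) (zeroˡ a) (distribʳ a)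

  dil : IntR n → IntR n
  dil = mapZ (dilate D)

  DegreeBelow : ℕ → IntR n → Set c
  DegreeBelow N = ListAll.All (λ p → degree (poly (proj₁ p)) < N)

  degreeBound : IntR n → ℕ
  degreeBound []            = 0
  degreeBound ((h , a) ∷ f) = suc (degree (poly h)) ℕ.⊔ degreeBound f

  degreeBound-below : ∀ f → DegreeBelow (degreeBound f) f
  degreeBound-below []            = []
  degreeBound-below ((h , a) ∷ f) =
    ℕP.m≤m⊔n _ (degreeBound f)
    ∷ ListAll.map (λ deg< → ℕP.<-≤-trans deg< (ℕP.m≤n⊔m (suc (degree (poly h))) _)) (degreeBound-below f)

  expansion : ∀ N f → DegreeBelow N f → f ∼ ∑box⊗ N n (λ ks → basis ks ⊗ coeff ks f)
  expansion N []            []               = ∼-sym (∑box-ε IntR-monoid N n _ (λ ks _ → ∼-zero (basis ks)))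
  expansion N ((h , a) ∷ f) (deg<N ∷ deg<Ns) = begin
    h ⊗ a ++ f
      ≈⟨ ∼-++ (⊗-∑box N n h a (λ ks → coefficient ks h) basis (basis-expansion N h deg<N)) (expansion N f deg<Ns) ⟩
    ∑box⊗ N n (λ ks → basis ks ⊗ (fromℤ (coefficient ks h) * a)) ++ ∑box⊗ N n (λ ks → basis ks ⊗ coeff ks f)
      ≈⟨ ∑box-∙ IntR-commutativeMonoid N n _ _ ⟨
    ∑box⊗ N n (λ ks → basis ks ⊗ (fromℤ (coefficient ks h) * a) ++ basis ks ⊗ coeff ks f)
      ≈⟨ ∑box-cong IntR-monoid N n (λ ks _ → ∼-sym (∼-addʳ (basis ks) _ _)) ⟩
    ∑box⊗ N n (λ ks → basis ks ⊗ coeff ks ((h , a) ∷ f)) ∎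
    where open SetoidReasoning ∼-setoid

  coeff-dil : ∀ N f → DegreeBelow N f → ∀ js →
              coeff js (dil f) ≈ ∑boxᴿ N n (λ ks → fromℤ (dilationEntry D js ks) * coeff ks f)
  coeff-dil N []            []               js = sym (∑box-ε R-monoid N n _ (λ ks _ → zeroʳ _))
  coeff-dil N ((h , a) ∷ f) (deg<N ∷ deg<Ns) js = begin
    fromℤ (coefficient js (dilate D h)) * a + coeff js (dil f)
      ≈⟨ +-cong (*-cong (trans (reflexive (≡.cong fromℤ (coefficient-dilate D N h deg<N js))) (fromℤ-∑boxℤ N n _)) refl)
                (coeff-dil N f deg<Ns js) ⟩
    ∑boxᴿ N n (λ ks → fromℤ (coefficient ks h ℤ.* Γ ks)) * a + ∑boxᴿ N n (λ ks → fromℤ (Γ ks) * coeff ks f)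
      ≈⟨ +-cong (*-distribʳ-∑boxᴿ a N n _) refl ⟩
    ∑boxᴿ N n (λ ks → fromℤ (coefficient ks h ℤ.* Γ ks) * a) + ∑boxᴿ N n (λ ks → fromℤ (Γ ks) * coeff ks f)
      ≈⟨ ∑box-∙ +-commutativeMonoid N n _ _ ⟨
    ∑boxᴿ N n (λ ks → fromℤ (coefficient ks h ℤ.* Γ ks) * a + fromℤ (Γ ks) * coeff ks f)
      ≈⟨ ∑box-cong R-monoid N n (λ ks _ → regroup (coefficient ks h) (Γ ks) (coeff ks f)) ⟩
    ∑boxᴿ N n (λ ks → fromℤ (Γ ks) * coeff ks ((h , a) ∷ f)) ∎
    where
    open SetoidReasoning setoid
    Γ : Vec ℕ n → ℤ
    Γ ks = dilationEntry D js ks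
    regroup : ∀ z γ y → fromℤ (z ℤ.* γ) * a + fromℤ γ * y ≈ fromℤ γ * (fromℤ z * a + y)
    regroup z γ y = begin
      fromℤ (z ℤ.* γ) * a + fromℤ γ * y        ≈⟨ +-cong (*-cong (trans (fromℤ-* z γ) (*-comm _ _)) refl) refl ⟩
      fromℤ γ * fromℤ z * a + fromℤ γ * y      ≈⟨ +-cong (*-assoc _ _ _) refl ⟩
      fromℤ γ * (fromℤ z * a) + fromℤ γ * y    ≈⟨ distribˡ _ _ _ ⟨
      fromℤ γ * (fromℤ z * a + y)              ∎

  u^ : ℕ → Carrier
  u^ zero    = 1#
  u^ (suc m) = u * u^ m

  D^*u^≈1 : ∀ m → fromℤ ((+ D) ℤ.^ m) * u^ m ≈ 1#
  D^*u^≈1 zero    = trans (*-identityʳ _) fromℤ-1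
  D^*u^≈1 (suc m) = begin
    fromℤ (+ D ℤ.* (+ D) ℤ.^ m) * (u * u^ m)             ≈⟨ *-cong (fromℤ-* (+ D) _) refl ⟩
    fromℤ (+ D) * fromℤ ((+ D) ℤ.^ m) * (u * u^ m)       ≈⟨ *-assoc _ _ _ ⟩
    fromℤ (+ D) * (fromℤ ((+ D) ℤ.^ m) * (u * u^ m))     ≈⟨ *-cong refl (trans (sym (*-assoc _ _ _))
                                                              (trans (*-cong (*-comm _ _) refl) (*-assoc _ _ _))) ⟩
    fromℤ (+ D) * (u * (fromℤ ((+ D) ℤ.^ m) * u^ m))     ≈⟨ *-assoc _ _ _ ⟨
    fromℤ (+ D) * u * (fromℤ ((+ D) ℤ.^ m) * u^ m)       ≈⟨ *-cong D*u≈1 (D^*u^≈1 m) ⟩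
    1# * 1#                                              ≈⟨ *-identityʳ 1# ⟩
    1#                                                   ∎
    where open SetoidReasoning setoid

  D^-cancel : ∀ m x → fromℤ ((+ D) ℤ.^ m) * x ≈ 0# → x ≈ 0#
  D^-cancel m x D^x≈0 = begin
    x                                       ≈⟨ *-identityˡ x ⟨
    1# * x                                  ≈⟨ *-cong (trans (*-comm _ _) (D^*u^≈1 m)) refl ⟨
    u^ m * fromℤ ((+ D) ℤ.^ m) * x          ≈⟨ *-assoc _ _ _ ⟩
    u^ m * (fromℤ ((+ D) ℤ.^ m) * x)        ≈⟨ *-cong refl D^x≈0 ⟩
    u^ m * 0#                               ≈⟨ zeroʳ _ ⟩
    0#                                      ∎
    where open SetoidReasoning setoid

  -- the coefficients of f are recovered from those of dil f by downward induction on |js|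
  dil-kernel : ∀ f → dil f ∼ [] → f ∼ []
  dil-kernel f dilf∼[] =
    ∼-trans (expansion N f (degreeBound-below f))
            (∑box-ε IntR-monoid N n _ (λ ks ks<N →
              ∼-trans (∼-congʳ (basis ks) _ _ (coeff-zero ks ks<N)) (∼-zero (basis ks))))
    where
    N = degreeBound f
    S = n ℕ.* N
    P : ℕ → Set ℓ
    P m = ∀ js → All (_< N) js → S ∸ Vec.sum js ≡ m → coeff js f ≈ 0#
    step : ∀ m → (∀ {m′} → m′ < m → P m′) → P m
    step m rec js js<N S∸|js|≡m = D^-cancel (Vec.sum js) (coeff js f) (begin
      fromℤ ((+ D) ℤ.^ Vec.sum js) * coeff js f
        ≈⟨ *-cong (reflexive (≡.cong fromℤ (dilationEntry-diagonal D js))) refl ⟨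
      fromℤ (dilationEntry D js js) * coeff js f
        ≈⟨ ∑box-single R-monoid N n _ js js<N off-diagonal ⟨
      ∑boxᴿ N n (λ ks → fromℤ (dilationEntry D js ks) * coeff ks f)
        ≈⟨ coeff-dil N f (degreeBound-below f) js ⟨
      coeff js (dil f)
        ≈⟨ coeff-∼ js dilf∼[] ⟩
      0# ∎)
      where
      open SetoidReasoning setoid
      off-diagonal : ∀ ks → All (_< N) ks → ks ≢ js → fromℤ (dilationEntry D js ks) * coeff ks f ≈ 0#
      off-diagonal ks ks<N ks≢js with Pointwise.decidable ℕP._≤?_ js ks
      ... | yes js≤ks = trans (*-cong refl (rec (≡.subst (S ∸ Vec.sum ks <_) S∸|js|≡m
                                                   (ℕP.∸-monoʳ-< (sum-< js≤ks (ks≢js ∘ ≡.sym)) (sum-bounded ks<N)))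
                                                 ks ks<N ≡.refl))
                              (zeroʳ _)
      ... | no  js≰ks = trans (*-cong (reflexive (≡.cong fromℤ (dilationEntry-high D js ks js≰ks))) refl) (zeroˡ _)
    coeff-zero : ∀ js → All (_< N) js → coeff js f ≈ 0#
    coeff-zero js js<N = <-rec P step (S ∸ Vec.sum js) js js<N ≡.refl

  dil-injective : ∀ f g → dil f ∼ dil g → f ∼ g
  dil-injective f g dilf∼dilg = begin
    f                              ≈⟨ ∼-≡ (ListP.++-identityʳ f) ⟨
    f ++ []                        ≈⟨ ∼-++ (∼-refl {f = f}) (∼-trans (∼-comm _ g) (++-scale-neg g)) ⟨
    f ++ (g′ ++ g)                 ≈⟨ ∼-≡ (ListP.++-assoc f g′ g) ⟨
    (f ++ g′) ++ g                 ≈⟨ ∼-++ (dil-kernel (f ++ g′) dil-difference) (∼-refl {f = g}) ⟩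
    g                              ∎
    where
    open SetoidReasoning ∼-setoid
    g′ = scale (- 1#) g
    dil-difference : dil (f ++ g′) ∼ []
    dil-difference = ∼-trans (∼-≡ (ListP.map-++ _ f g′))
                       (∼-trans (∼-++ dilf∼dilg (∼-≡ (≡.sym (scale-mapZ (- 1#) (dilate D) g))))
                                (++-scale-neg (dil g)))

  Image : IntR n → Set (c ⊔ ℓ)
  Image g = Σ (IntR n) (λ f → dil f ∼ g)

  image-∼ : ∀ {g g′} → g ∼ g′ → Image g → Image g′
  image-∼ g∼g′ (f , dilf∼g) = f , ∼-trans dilf∼g g∼g′

  image-[] : Image []
  image-[] = [] , ∼-refl

  image-++ : ∀ {g g′} → Image g → Image g′ → Image (g ++ g′)
  image-++ (f , dilf∼g) (f′ , dilf′∼g′) = f ++ f′ , ∼-trans (∼-≡ (ListP.map-++ _ f f′)) (∼-++ dilf∼g dilf′∼g′)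

  image-scale : ∀ r {g} → Image g → Image (scale r g)
  image-scale r (f , dilf∼g) = scale r f , ∼-trans (∼-≡ (≡.sym (scale-mapZ r (dilate D) f))) (scale-∼ r dilf∼g)

  image-cancel : ∀ {g g′} → Image (g ++ g′) → Image g′ → Image g
  image-cancel {g} {g′} im im′ =
    image-∼ (∼-trans (∼-≡ (ListP.++-assoc g g′ _)) (∼-trans (∼-++ (∼-refl {f = g}) (++-scale-neg g′)) (∼-≡ (ListP.++-identityʳ g))))
            (image-++ im (image-scale (- 1#) im′))

  image-∑box⊗ : ∀ N m (F : Vec ℕ m → IntR n) → (∀ ks → All (_< N) ks → Image (F ks)) → Image (∑box⊗ N m F)
  image-∑box⊗ = ∑box-closed IntR-monoid Image image-∼ image-[] image-++

  basisBound : Vec ℕ n → ℕ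
  basisBound ks = suc (degree (poly (dilate D (basis ks))) ℕ.⊔ Vec.sum ks)

  basis-below-basisBound : ∀ ks → All (_< basisBound ks) ks
  basis-below-basisBound ks = All.map (λ k≤ → s≤s (ℕP.≤-trans k≤ (ℕP.m≤n⊔m _ _))) (entries-≤-sum ks)

  dil-basis : ∀ ks → dil (basis ks ⊗ 1#) ∼ ∑box⊗ (basisBound ks) n (λ js → basis js ⊗ (fromℤ (dilationEntry D js ks) * 1#))
  dil-basis ks = ⊗-∑box N n (dilate D (basis ks)) 1# (λ js → dilationEntry D js ks) basis (λ x →
    ≡.trans (basis-expansion N (dilate D (basis ks)) (s≤s (ℕP.m≤m⊔n _ _)) x)
            (∑box-cong ℤ-monoid N n (λ js _ → ≡.cong (ℤ._* _) (coefficient-dilate-basis D js ks))))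
    where N = basisBound ks

  rescale : ∀ m a → a * u^ m * (fromℤ ((+ D) ℤ.^ m) * 1#) ≈ a
  rescale m a = begin
    a * u^ m * (fromℤ ((+ D) ℤ.^ m) * 1#)    ≈⟨ *-cong refl (*-identityʳ _) ⟩
    a * u^ m * fromℤ ((+ D) ℤ.^ m)           ≈⟨ *-assoc _ _ _ ⟩
    a * (u^ m * fromℤ ((+ D) ℤ.^ m))         ≈⟨ *-cong refl (trans (*-comm _ _) (D^*u^≈1 m)) ⟩
    a * 1#                                   ≈⟨ *-identityʳ a ⟩
    a                                        ∎
    where open SetoidReasoning setoid

  -- by induction on |ks|, using that dil (basis ks ⊗ 1) is D^|ks| basis ks ⊗ 1 plus lower terms
  basis-image : ∀ ks a → Image (basis ks ⊗ a)
  basis-image ks = <-rec Q step (Vec.sum ks) ks ≡.refl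
    where
    Q : ℕ → Set (c ⊔ ℓ)
    Q m = ∀ ks → Vec.sum ks ≡ m → ∀ a → Image (basis ks ⊗ a)
    step : ∀ m → (∀ {m′} → m′ < m → Q m′) → Q m
    step m rec ks |ks|≡m a =
      image-∼ (∼-congʳ (basis ks) _ _ (trans (*-cong refl (*-cong (reflexive (≡.cong fromℤ (dilationEntry-diagonal D ks))) refl))
                                             (rescale (Vec.sum ks) a)))
              (image-scale (a * u^ (Vec.sum ks)) (image-cancel (image-∼ extract (basis ks ⊗ 1# , dil-basis ks)) rest))
      where
      N = basisBound ks
      T : Vec ℕ n → IntR n
      T js = basis js ⊗ (fromℤ (dilationEntry D js ks) * 1#)
      extract : ∑box⊗ N n T ∼ T ks ++ ∑box⊗ N n (omit IntR-commutativeMonoid ks T)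
      extract = ∑box-extract IntR-commutativeMonoid N n T ks (basis-below-basisBound ks)
      lower : ∀ js → js ≢ ks → Image (T js)
      lower js js≢ks with Pointwise.decidable ℕP._≤?_ js ks
      ... | yes js≤ks = rec (≡.subst (Vec.sum js <_) |ks|≡m (sum-< js≤ks js≢ks)) js ≡.refl _
      ... | no  js≰ks = image-∼ (∼-sym (∼-trans (∼-congʳ (basis js) _ _
                          (trans (*-cong (reflexive (≡.cong fromℤ (dilationEntry-high D js ks js≰ks))) refl) (zeroˡ _)))
                          (∼-zero (basis js)))) image-[]
      omitted : ∀ js → Dec (js ≡ ks) → Image (omit IntR-commutativeMonoid ks T js)
      omitted js (yes ≡.refl) = image-∼ (∼-sym (omit-self IntR-commutativeMonoid ks T)) image-[]
      omitted js (no js≢ks)   = image-∼ (∼-sym (omit-other IntR-commutativeMonoid ks T js js≢ks)) (lower js js≢ks)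
      rest : Image (∑box⊗ N n (omit IntR-commutativeMonoid ks T))
      rest = image-∑box⊗ N n _ (λ js _ → omitted js (VecP.≡-dec ℕ._≟_ js ks))

  dil-surjective : ∀ g → Image g
  dil-surjective g = image-∼ (∼-sym (expansion N g (degreeBound-below g)))
                             (image-∑box⊗ N n _ (λ ks _ → basis-image ks (coeff ks g)))
    where N = degreeBound g

module Restriction {c ℓ} (R : CommutativeRing c ℓ) where

  open import Data.Nat using (zero; suc)
  open import Data.Integer as ℤ using (-[1+_])
  import Data.Integer.Properties as ℤP
  open import Data.Fin using (Fin)
  import Data.List.Properties as ListP
  open import Data.Product using (Σ; _×_; _,_; proj₁; proj₂; ∃₂)
  open import Algebra.Properties.Semiring.Sum ℤP.+-*-semiring using (sum-cong-≗; *-distribˡ-sum)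
  open import Function using (_∘_)
  open import Relation.Binary.PropositionalEquality as ≡ using (_≡_)
  open Tensor R
  open TensorProduct R
  open IntegerValued using (fun-cong; dilate)
  open Determinants

  sumℤ-cong : ∀ {n} {f g : Fin n → ℤ} → (∀ j → f j ≡ g j) → sumℤ f ≡ sumℤ g
  sumℤ-cong {f = f} {g} f≗g = ≡.trans (sumℤ≡sum f) (≡.trans (sum-cong-≗ f≗g) (≡.sym (sumℤ≡sum g)))

  *-distribˡ-sumℤ : ∀ {n} s (f : Fin n → ℤ) → s ℤ.* sumℤ f ≡ sumℤ (λ j → s ℤ.* f j)
  *-distribˡ-sumℤ s f = ≡.trans (≡.cong (s ℤ.*_) (sumℤ≡sum f))
                                (≡.trans (*-distribˡ-sum s f) (≡.sym (sumℤ≡sum (λ j → s ℤ.* f j))))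

  apply-cong : ∀ {n} (M : Mat n) {x y : Pt n} → (∀ j → x j ≡ y j) → ∀ i → apply M x i ≡ apply M y i
  apply-cong M x≗y i = sumℤ-cong (λ j → ≡.cong (M i j ℤ.*_) (x≗y j))

  apply-*-matrix : ∀ {n} s (A : Mat n) x i → apply (λ i j → s ℤ.* A i j) x i ≡ s ℤ.* apply A x i
  apply-*-matrix s A x i =
    ≡.trans (sumℤ-cong (λ j → ℤP.*-assoc s (A i j) (x j))) (≡.sym (*-distribˡ-sumℤ s (λ j → A i j ℤ.* x j)))

  apply-*-vector : ∀ {n} s (M : Mat n) x i → apply M (λ j → s ℤ.* x j) i ≡ s ℤ.* apply M x i
  apply-*-vector s M x i =
    ≡.trans (sumℤ-cong (λ j → ≡.trans (≡.sym (ℤP.*-assoc (M i j) s (x j)))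
                               (≡.trans (≡.cong (ℤ._* x j) (ℤP.*-comm (M i j) s)) (ℤP.*-assoc s (M i j) (x j)))))
            (≡.sym (*-distribˡ-sumℤ s (λ j → M i j ℤ.* x j)))

  sign : ℤ → ℤ
  sign (+ _)    = + 1
  sign -[1+ _ ] = ℤ.- + 1

  sign-* : ∀ z → sign z ℤ.* z ≡ + ∣ z ∣
  sign-* (+ k)    = ℤP.*-identityˡ (+ k)
  sign-* -[1+ k ] = ℤP.-1*i≡-i -[1+ k ]

  inverse-up-to-det : ∀ {n} (M : Mat n) → ∃₂ λ (X Y : Mat n) →
                      (∀ x i → apply M (apply X x) i ≡ + ∣ det M ∣ ℤ.* x i) ×
                      (∀ x i → apply Y (apply M x) i ≡ + ∣ det M ∣ ℤ.* x i)
  inverse-up-to-det {zero}  M = M , M , (λ _ ()) , (λ _ ())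
  inverse-up-to-det {suc m} M = X , Y , MX≡ , YM≡
    where
    s = sign (det M)
    X Y : Mat (suc m)
    X i j = s ℤ.* adjugateᵀ M i j
    Y i j = s ℤ.* adjugate M i j
    |det|-* : ∀ z → s ℤ.* (det M ℤ.* z) ≡ + ∣ det M ∣ ℤ.* z
    |det|-* z = ≡.trans (≡.sym (ℤP.*-assoc s (det M) z)) (≡.cong (ℤ._* z) (sign-* (det M)))
    MX≡ : ∀ x i → apply M (apply X x) i ≡ + ∣ det M ∣ ℤ.* x i
    MX≡ x i = ≡.trans (apply-cong M (apply-*-matrix s (adjugateᵀ M) x) i)
              (≡.trans (apply-*-vector s M (apply (adjugateᵀ M) x) i)
              (≡.trans (≡.cong (s ℤ.*_) (apply-adjugateᵀ M x i)) (|det|-* (x i))))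
    YM≡ : ∀ x i → apply Y (apply M x) i ≡ + ∣ det M ∣ ℤ.* x i
    YM≡ x i = ≡.trans (apply-*-matrix s (adjugate M) (apply M x) i)
              (≡.trans (≡.cong (s ℤ.*_) (apply-adjugate M x i)) (|det|-* (x i)))

  restrict-∼ : ∀ {n} (M : Mat n) {f g} → f ∼ g → restrict M f ∼ restrict M g
  restrict-∼ M = mapZ-∼ (apply M) (restrictZ M) (λ _ _ → ≡.refl)

  restrict-restrict : ∀ {n} (A B : Mat n) D → (∀ x i → apply A (apply B x) i ≡ + D ℤ.* x i) →
                      ∀ f → restrict B (restrict A f) ∼ mapZ (dilate D) f
  restrict-restrict A B D AB≡ f =
    ∼-trans (∼-≡ (≡.sym (ListP.map-∘ f)))
            (mapZ-cong (restrictZ B ∘ restrictZ A) (dilate D) (λ h x → fun-cong h (AB≡ x)) f)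

  restriction-bijective : ∀ {n} (M : Mat n) → det M ≢ + 0 → IsUnit (fromℤ (+ ∣ det M ∣)) →
    ((f g : IntR n) → f ∼ g → restrict M f ∼ restrict M g)
    × ((f g : IntR n) → restrict M f ∼ restrict M g → f ∼ g)
    × ((g : IntR n) → Σ (IntR n) (λ f → restrict M f ∼ g))
  restriction-bijective M _ |det|-unit = (λ f g → restrict-∼ M) , injective , surjective
    where
    open Dilation R ∣ det M ∣ |det|-unit using (dil-injective; dil-surjective)
    X = proj₁ (inverse-up-to-det M)
    Y = proj₁ (proj₂ (inverse-up-to-det M))
    MX≡ = proj₁ (proj₂ (proj₂ (inverse-up-to-det M)))
    YM≡ = proj₂ (proj₂ (proj₂ (inverse-up-to-det M)))
    injective : ∀ f g → restrict M f ∼ restrict M g → f ∼ g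
    injective f g Mf∼Mg = dil-injective f g
      (∼-trans (∼-sym (restrict-restrict M X ∣ det M ∣ MX≡ f)) (∼-trans (restrict-∼ X Mf∼Mg) (restrict-restrict M X ∣ det M ∣ MX≡ g)))
    surjective : ∀ g → Σ (IntR _) (λ f → restrict M f ∼ g)
    surjective g = restrict Y (proj₁ (dil-surjective g)) ,
                   ∼-trans (restrict-restrict Y M ∣ det M ∣ YM≡ (proj₁ (dil-surjective g))) (proj₂ (dil-surjective g))

module Translation {c ℓ} (R : CommutativeRing c ℓ) where

  open import Data.Nat using (suc)
  import Data.Nat.Properties as ℕP
  open import Data.List using (List; []; _∷_; concatMap)
  import Data.List.Properties as ListP
  open import Data.Vec using (Vec)
  open import Data.Product using (Σ; _×_; _,_; proj₁; proj₂)
  import Relation.Binary.PropositionalEquality as ≡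
  import Relation.Binary.Reasoning.Setoid as SetoidReasoning
  open CommutativeRing R
  open Tensor R
  open TensorProduct R
  open IntegerValued using (degree)
  open NewtonExpansion using (basis; Δᴷ; translation-expansion)
  open BoxSums

  module _ {n : ℕ} where

    private
      Pairs = IntR n × IntR n

    boxList : ℕ → (m : ℕ) → (Vec ℕ m → Pairs) → List Pairs
    boxList N m F = ∑box (ListP.++-monoid Pairs) N m (λ ks → F ks ∷ [])

    combo-boxList : ∀ l N m (F : Vec ℕ m → Pairs) →
                    combo l (boxList N m F) ∼ ∑box⊗ N m (λ ks → scale (value (proj₂ (F ks)) l) (proj₁ (F ks)))
    combo-boxList l N m F = begin
      combo l (boxList N m F)
        ≡⟨ ∑box-homo (ListP.++-monoid Pairs) (ListP.++-monoid (IntZ n × Carrier)) (combo l) (≡.cong (combo l)) ≡.refl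
                     (λ xs ys → ListP.concatMap-++ _ xs ys) N m _ ⟩
      ∑box (ListP.++-monoid _) N m (λ ks → combo l (F ks ∷ []))
        ≈⟨ ∑box-homo (ListP.++-monoid _) IntR-monoid (λ f → f) ∼-≡ ∼-refl (λ _ _ → ∼-refl) N m _ ⟩
      ∑box⊗ N m (λ ks → combo l (F ks ∷ []))
        ≈⟨ ∑box-cong IntR-monoid N m (λ ks _ → ∼-≡ (ListP.++-identityʳ _)) ⟩
      ∑box⊗ N m (λ ks → scale (value (proj₂ (F ks)) l) (proj₁ (F ks))) ∎
      where open SetoidReasoning ∼-setoid

    translationPairs : IntZ n × Carrier → List Pairs
    translationPairs (h , a) =
      boxList (suc (degree (poly h))) n (λ ks → Δᴷ ks h ⊗ a , basis ks ⊗ 1#)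

    translate-⊗ : ∀ l h a → translate l (h ⊗ a) ∼ combo l (translationPairs (h , a))
    translate-⊗ l h a = ∼-trans
      (⊗-∑box N n (shiftZ l h) a (λ ks → fun (basis ks) l) (λ ks → Δᴷ ks h)
              (λ x → translation-expansion N h ℕP.≤-refl x l))
      (∼-sym (∼-trans (combo-boxList l N n _)
               (∑box-cong IntR-monoid N n (λ ks _ → ∼-congʳ (Δᴷ ks h) _ _
                  (*-cong (trans (+-identityʳ _) (*-identityʳ _)) refl)))))
      where N = suc (degree (poly h))

    translation-finite : (f : IntR n) → Σ (List Pairs) (λ fgs → (l : Pt n) → translate l f ∼ combo l fgs)
    translation-finite f = concatMap translationPairs f , λ l → translate-∼-combo l f
      where
      translate-∼-combo : ∀ l f → translate l f ∼ combo l (concatMap translationPairs f)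
      translate-∼-combo l []            = ∼-refl
      translate-∼-combo l ((h , a) ∷ f) = ∼-trans (∼-++ (translate-⊗ l h a) (translate-∼-combo l f))
        (∼-≡ (≡.sym (ListP.concatMap-++ _ (translationPairs (h , a)) (concatMap translationPairs f))))

lemma2p2 : ∀ {c ℓ : Level} (R : CommutativeRing c ℓ) (n : ℕ) →
    let open Tensor R in
    ((M : Mat n) → det M ≢ + 0 → IsUnit (fromℤ (+ ∣ det M ∣)) →
      ((f g : IntR n) → f ∼ g → restrict M f ∼ restrict M g)
      × ((f g : IntR n) → restrict M f ∼ restrict M g → f ∼ g)
      × ((g : IntR n) → Σ (IntR n) (λ f → restrict M f ∼ g)))
    ×
    ((f : IntR n) → Σ (List (IntR n × IntR n))
      (λ fgs → (l : Pt n) → translate l f ∼ combo l fgs))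
lemma2p2 R n = Restriction.restriction-bijective R , Translation.translation-finite R
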